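{- Let $|q|<1$. For integers $k\ge 2$ and $i\in\{1,\dots,k-1\}$, \[ \sum_{n=0}^{\infty}\frac{q^{kn^2}(q^i;q^k)_n(q^{k-i};q^k)_n}{(q^k;q^k)_{2n}}=\frac{(q^{k+i};q^{3k})_\infty(q^{2k-i};q^{3k})_\infty(q^{3k};q^{3k})_\infty}{(q^k;q^k)_\infty} \] and \[ \sum_{n=0}^{\infty}\frac{q^{kn(n+1)}(1-q^{kn+i})(q^i;q^k)_n(q^{k-i};q^k)_n}{(q^k;q^k)_{2n+1}}=\frac{(q^{i};q^{3k})_\infty(q^{3k-i};q^{3k})_\infty(q^{3k};q^{3k})_\infty}{(q^k;q^k)_\infty}. \]
   Context: For $n\ge 0$, $(a;p)_n=\prod_{i=0}^{n-1}(1-ap^i)$ and $(a;p)_\infty=\prod_{i\ge0}(1-ap^i)$. -}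

module Defs where

open import Data.Nat using (ℕ; zero; suc; _∸_; _≡ᵇ_)
import Data.Nat as ℕ
open import Data.Integer using (ℤ; +_; -_; _+_; _*_; _-_)
open import Data.List using (List; []; _∷_)
open import Data.Bool using (if_then_else_)

-- Formal power series in q with integer coefficients: f m = coefficient of q^m.
FPS : Set
FPS = ℕ → ℤ

sumUpTo : ℕ → (ℕ → ℤ) → ℤ
sumUpTo zero    f = f 0
sumUpTo (suc n) f = sumUpTo n f + f (suc n)

qpow : ℕ → FPS
qpow e m = if m ≡ᵇ e then + 1 else + 0

one : FPS
one = qpow 0

_⊕_ : FPS → FPS → FPS
(f ⊕ g) m = f m + g m

_⊖_ : FPS → FPS → FPS
(f ⊖ g) m = f m - g m

_⊗_ : FPS → FPS → FPS
(f ⊗ g) m = sumUpTo m (λ j → f j * g (m ∸ j))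

infixl 6 _⊕_ _⊖_
infixl 7 _⊗_

_^ₛ_ : FPS → ℕ → FPS
f ^ₛ zero  = one
f ^ₛ suc n = f ^ₛ n ⊗ f

prodBelow : ℕ → (ℕ → FPS) → FPS
prodBelow zero    F = one
prodBelow (suc n) F = prodBelow n F ⊗ F n

-- Multiplicative inverse of a series f with f 0 = 1 (b_0 = 1,
-- b_m = - Σ_{j=1}^{m} f_j b_{m-j}).  invRev f m = [b_m, b_{m-1}, ..., b_0].
private
  dot : FPS → ℕ → List ℤ → ℤ
  dot f j []       = + 0
  dot f j (b ∷ bs) = f (suc j) * b + dot f (suc j) bs

invRev : FPS → ℕ → List ℤ
invRev f zero    = + 1 ∷ []
invRev f (suc m) = let bs = invRev f m in (- dot f 0 bs) ∷ bs

headℤ : List ℤ → ℤ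
headℤ []      = + 0
headℤ (x ∷ _) = x

inv : FPS → FPS
inv f m = headℤ (invRev f m)

-- division by a series with constant term 1
_⊘_ : FPS → FPS → FPS
f ⊘ g = f ⊗ inv g

infixl 7 _⊘_

poch : FPS → FPS → ℕ → FPS
poch a p n = prodBelow n (λ i → one ⊖ a ⊗ (p ^ₛ i))

-- (a;p)_∞ for a, p with zero constant term: the factor (1 - a p^i) is
-- 1 + O(q^{i+1}), so the coefficient of q^m is that of the partial product
-- over i ≤ m.
pochInf : FPS → FPS → FPS
pochInf a p m = poch a p (suc m) m

-- Σ_{n≥0} T n for terms with T n = O(q^n): coefficient of q^m is
-- Σ_{n≤m} (T n)_m.
sumInf : (ℕ → FPS) → FPS
sumInf T m = sumUpTo m (λ n → T n m)

{-# OPTIONS --safe #-}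

-- With k = i + j, the finite Jacobi triple product expands (q^i; q^k)_{n+e} (q^j; q^k)_n as a
-- signed sum of powers of q against the Gaussian binomials [2n+e, t] in base q^k. Dividing by
-- (q^k; q^k)_{2n+e} turns [2n+e, t] into 1 / ((q^k; q^k)_t (q^k; q^k)_{2n+e-t}). After exchanging
-- the sums over n and t, each inner sum is, up to a power of q^k, a Durfee rectangle sum
-- Σ_s q^{k s (s+m)} / ((q^k; q^k)_s (q^k; q^k)_{s+m}) = 1 / (q^k; q^k)_∞, and what remains is a
-- theta series in base q^{3k}, which the Jacobi triple product turns into the product side.

module Submission where

open import Defs
open import Data.Nat using (ℕ; _≤_; _<_; _+_; _*_; _∸_)
open import Relation.Binary.PropositionalEquality using (_≡_)
open import Data.Product using (_×_)

open import Data.Nat using (zero; suc; z≤n; s≤s; _≡ᵇ_; _<?_)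
import Data.Nat.Properties as ℕ
import Data.Nat.Tactic.RingSolver as ℕ-Solver
open import Data.Integer using (ℤ; +_)
  renaming (_+_ to _+ᶻ_; _*_ to _*ᶻ_; -_ to -ᶻ_; _-_ to _-ᶻ_)
import Data.Integer.Properties as ℤ
import Data.Integer.Tactic.RingSolver as ℤ-Solver
open import Data.Bool using (true; false; if_then_else_; T)
open import Data.Empty using (⊥-elim)
open import Data.List using (List)
open import Data.Maybe using (Maybe; just; nothing)
open import Data.Product using (_,_)
open import Data.Sum using (inj₁; inj₂)
open import Data.Unit using (tt)
open import Level using (0ℓ)
open import Relation.Binary.PropositionalEquality
  using (refl; sym; trans; cong; cong₂; subst; module ≡-Reasoning)
open import Relation.Nullary using (yes; no)
open import Algebra.Bundles using (CommutativeRing)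
open import Algebra.Structures using (IsCommutativeRing)
import Algebra.Properties.Ring
import Algebra.Solver.Ring
import Algebra.Solver.Ring.AlmostCommutativeRing as ACR
import Relation.Binary.Reasoning.Setoid

sumUpTo-cong : ∀ n {f g : ℕ → ℤ} → (∀ j → j ≤ n → f j ≡ g j) → sumUpTo n f ≡ sumUpTo n g
sumUpTo-cong zero    f≡g = f≡g 0 z≤n
sumUpTo-cong (suc n) f≡g =
  cong₂ _+ᶻ_ (sumUpTo-cong n (λ j j≤n → f≡g j (ℕ.m≤n⇒m≤1+n j≤n))) (f≡g (suc n) ℕ.≤-refl)

sumUpTo-zero : ∀ n {f : ℕ → ℤ} → (∀ j → j ≤ n → f j ≡ + 0) → sumUpTo n f ≡ + 0
sumUpTo-zero zero    f≡0 = f≡0 0 z≤n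
sumUpTo-zero (suc n) f≡0 =
  cong₂ _+ᶻ_ (sumUpTo-zero n (λ j j≤n → f≡0 j (ℕ.m≤n⇒m≤1+n j≤n))) (f≡0 (suc n) ℕ.≤-refl)

sumUpTo-+ : ∀ n (f g : ℕ → ℤ) → sumUpTo n (λ j → f j +ᶻ g j) ≡ sumUpTo n f +ᶻ sumUpTo n g
sumUpTo-+ zero    f g = refl
sumUpTo-+ (suc n) f g rewrite sumUpTo-+ n f g =
  interchange (sumUpTo n f) (sumUpTo n g) (f (suc n)) (g (suc n))
  where
  interchange : ∀ a b c d → (a +ᶻ b) +ᶻ (c +ᶻ d) ≡ (a +ᶻ c) +ᶻ (b +ᶻ d)
  interchange = ℤ-Solver.solve-∀

sumUpTo-*ˡ : ∀ n c (f : ℕ → ℤ) → c *ᶻ sumUpTo n f ≡ sumUpTo n (λ j → c *ᶻ f j)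
sumUpTo-*ˡ zero    c f = refl
sumUpTo-*ˡ (suc n) c f rewrite sym (sumUpTo-*ˡ n c f) = ℤ.*-distribˡ-+ c (sumUpTo n f) (f (suc n))

sumUpTo-shift : ∀ n (f : ℕ → ℤ) → sumUpTo (suc n) f ≡ f 0 +ᶻ sumUpTo n (λ j → f (suc j))
sumUpTo-shift zero    f = refl
sumUpTo-shift (suc n) f rewrite sumUpTo-shift n f =
  ℤ.+-assoc (f 0) (sumUpTo n (λ j → f (suc j))) (f (suc (suc n)))

sumUpTo-swap : ∀ n m (h : ℕ → ℕ → ℤ) →
  sumUpTo n (λ a → sumUpTo m (h a)) ≡ sumUpTo m (λ b → sumUpTo n (λ a → h a b))
sumUpTo-swap zero    m h = refl
sumUpTo-swap (suc n) m h rewrite sumUpTo-swap n m h =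
  sym (sumUpTo-+ m (λ b → sumUpTo n (λ a → h a b)) (h (suc n)))

sumUpTo-reverse : ∀ n (f : ℕ → ℤ) → sumUpTo n f ≡ sumUpTo n (λ j → f (n ∸ j))
sumUpTo-reverse zero    f = refl
sumUpTo-reverse (suc n) f = begin
  sumUpTo n f +ᶻ f (suc n)                   ≡⟨ cong (_+ᶻ f (suc n)) (sumUpTo-reverse n f) ⟩
  sumUpTo n (λ j → f (n ∸ j)) +ᶻ f (suc n)   ≡⟨ ℤ.+-comm _ (f (suc n)) ⟩
  f (suc n) +ᶻ sumUpTo n (λ j → f (n ∸ j))   ≡⟨ sym (sumUpTo-shift n (λ j → f (suc n ∸ j))) ⟩
  sumUpTo (suc n) (λ j → f (suc n ∸ j))      ∎
  where open ≡-Reasoning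

sumUpTo-triangle : ∀ m (X : ℕ → ℕ → ℤ) →
  sumUpTo m (λ j → sumUpTo j (λ l → X l j)) ≡ sumUpTo m (λ l → sumUpTo (m ∸ l) (λ d → X l (l + d)))
sumUpTo-triangle zero    X = refl
sumUpTo-triangle (suc m) X = begin
    sumUpTo m (λ j → sumUpTo j (λ l → X l j)) +ᶻ (column +ᶻ X (suc m) (suc m))
  ≡⟨ cong (_+ᶻ (column +ᶻ X (suc m) (suc m))) (sumUpTo-triangle m X) ⟩
    rows m +ᶻ (column +ᶻ X (suc m) (suc m))
  ≡⟨ sym (ℤ.+-assoc (rows m) column _) ⟩
    (rows m +ᶻ column) +ᶻ X (suc m) (suc m)
  ≡⟨ cong₂ _+ᶻ_ (trans (sym (sumUpTo-+ m _ _)) (sumUpTo-cong m extendRow))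
                (cong (X (suc m)) (sym (ℕ.+-identityʳ (suc m)))) ⟩
    sumUpTo m (λ l → sumUpTo (suc m ∸ l) (λ d → X l (l + d))) +ᶻ X (suc m) (suc m + 0)
  ≡⟨ cong (λ z → sumUpTo m (λ l → sumUpTo (suc m ∸ l) (λ d → X l (l + d)))
                 +ᶻ sumUpTo z (λ d → X (suc m) (suc m + d))) (sym (ℕ.n∸n≡0 m)) ⟩
    rows (suc m)
  ∎
  where
  open ≡-Reasoning
  rows : ℕ → ℤ
  rows m = sumUpTo m (λ l → sumUpTo (m ∸ l) (λ d → X l (l + d)))
  column : ℤ
  column = sumUpTo m (λ l → X l (suc m))
  extendRow : ∀ l → l ≤ m →
    sumUpTo (m ∸ l) (λ d → X l (l + d)) +ᶻ X l (suc m) ≡ sumUpTo (suc m ∸ l) (λ d → X l (l + d))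
  extendRow l l≤m rewrite ℕ.+-∸-assoc 1 l≤m =
    cong (λ z → sumUpTo (m ∸ l) (λ d → X l (l + d)) +ᶻ X l z)
         (sym (trans (ℕ.+-suc l (m ∸ l)) (cong suc (ℕ.m+[n∸m]≡n l≤m))))

sumUpTo-extend : ∀ M m (g : ℕ → ℤ) → m ≤ M → (∀ n → m < n → n ≤ M → g n ≡ + 0) →
  sumUpTo M g ≡ sumUpTo m g
sumUpTo-extend zero    zero g z≤n vanish = refl
sumUpTo-extend (suc M) m  g m≤M vanish with ℕ.m≤n⇒m<n∨m≡n m≤M
... | inj₂ refl       = refl
... | inj₁ (s≤s m≤M′) =
  trans (cong₂ _+ᶻ_ (sumUpTo-extend M m g m≤M′ (λ n m<n n≤M → vanish n m<n (ℕ.m≤n⇒m≤1+n n≤M)))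
                    (vanish (suc M) (s≤s m≤M′) ℕ.≤-refl))
        (ℤ.+-identityʳ _)

infix 4 _≈_
record _≈_ (f g : FPS) : Set where
  constructor mk≈
  field at : ∀ m → f m ≡ g m
open _≈_ public

0ₛ : FPS
0ₛ _ = + 0

infix 8 ⊝_
⊝_ : FPS → FPS
(⊝ f) m = -ᶻ f m

≈-refl : ∀ {f} → f ≈ f
≈-refl = mk≈ λ m → refl

≈-reflexive : ∀ {f g} → f ≡ g → f ≈ g
≈-reflexive refl = ≈-refl

≈-sym : ∀ {f g} → f ≈ g → g ≈ f
≈-sym f≈g = mk≈ λ m → sym (at f≈g m)

≈-trans : ∀ {f g h} → f ≈ g → g ≈ h → f ≈ h
≈-trans f≈g g≈h = mk≈ λ m → trans (at f≈g m) (at g≈h m)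

⊗-cong : ∀ {f f′ g g′} → f ≈ f′ → g ≈ g′ → f ⊗ g ≈ f′ ⊗ g′
⊗-cong f≈f′ g≈g′ = mk≈ λ m → sumUpTo-cong m (λ j _ → cong₂ _*ᶻ_ (at f≈f′ j) (at g≈g′ (m ∸ j)))

⊗-comm : ∀ f g → f ⊗ g ≈ g ⊗ f
⊗-comm f g = mk≈ λ m → trans (sumUpTo-reverse m _) (sumUpTo-cong m λ j j≤m →
  trans (ℤ.*-comm (f (m ∸ j)) (g (m ∸ (m ∸ j)))) (cong (λ i → g i *ᶻ f (m ∸ j)) (ℕ.m∸[m∸n]≡n j≤m)))

⊗-assoc : ∀ f g h → (f ⊗ g) ⊗ h ≈ f ⊗ (g ⊗ h)
⊗-assoc f g h = mk≈ λ m → begin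
    sumUpTo m (λ j → sumUpTo j (λ l → f l *ᶻ g (j ∸ l)) *ᶻ h (m ∸ j))
  ≡⟨ sumUpTo-cong m (λ j _ → trans (ℤ.*-comm _ (h (m ∸ j))) (trans (sumUpTo-*ˡ j (h (m ∸ j)) _)
       (sumUpTo-cong j (λ l _ → ℤ.*-comm (h (m ∸ j)) _)))) ⟩
    sumUpTo m (λ j → sumUpTo j (λ l → (f l *ᶻ g (j ∸ l)) *ᶻ h (m ∸ j)))
  ≡⟨ sumUpTo-triangle m (λ l j → (f l *ᶻ g (j ∸ l)) *ᶻ h (m ∸ j)) ⟩
    sumUpTo m (λ l → sumUpTo (m ∸ l) (λ d → (f l *ᶻ g (l + d ∸ l)) *ᶻ h (m ∸ (l + d))))
  ≡⟨ sumUpTo-cong m (λ l _ → trans (sumUpTo-cong (m ∸ l) (λ d _ →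
       trans (ℤ.*-assoc (f l) _ _)
             (cong₂ (λ a b → f l *ᶻ (g a *ᶻ h b)) (ℕ.m+n∸m≡n l d) (sym (ℕ.∸-+-assoc m l d)))))
       (sym (sumUpTo-*ˡ (m ∸ l) (f l) _))) ⟩
    sumUpTo m (λ l → f l *ᶻ sumUpTo (m ∸ l) (λ d → g d *ᶻ h (m ∸ l ∸ d)))
  ∎
  where open ≡-Reasoning

⊗-identityˡ : ∀ f → one ⊗ f ≈ f
⊗-identityˡ f = mk≈ λ where
  zero    → ℤ.*-identityˡ (f 0)
  (suc m) → trans (sumUpTo-shift m _)
                  (trans (cong₂ _+ᶻ_ (ℤ.*-identityˡ (f (suc m))) (sumUpTo-zero m (λ j _ → refl)))
                         (ℤ.+-identityʳ (f (suc m))))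

⊗-distribˡ-⊕ : ∀ f g h → f ⊗ (g ⊕ h) ≈ f ⊗ g ⊕ f ⊗ h
⊗-distribˡ-⊕ f g h = mk≈ λ m →
  trans (sumUpTo-cong m (λ j _ → ℤ.*-distribˡ-+ (f j) (g (m ∸ j)) (h (m ∸ j)))) (sumUpTo-+ m _ _)

⊕-⊗-isCommutativeRing : IsCommutativeRing _≈_ _⊕_ _⊗_ ⊝_ 0ₛ one
⊕-⊗-isCommutativeRing = record
  { isRing = record
    { +-isAbelianGroup = record
      { isGroup = record
        { isMonoid = record
          { isSemigroup = record
            { isMagma = record
              { isEquivalence = record { refl = ≈-refl ; sym = ≈-sym ; trans = ≈-trans }
              ; ∙-cong = λ f≈f′ g≈g′ → mk≈ λ m → cong₂ _+ᶻ_ (at f≈f′ m) (at g≈g′ m) }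
            ; assoc = λ f g h → mk≈ λ m → ℤ.+-assoc (f m) (g m) (h m) }
          ; identity = (λ f → mk≈ λ m → ℤ.+-identityˡ (f m)) , (λ f → mk≈ λ m → ℤ.+-identityʳ (f m)) }
        ; inverse = (λ f → mk≈ λ m → ℤ.+-inverseˡ (f m)) , (λ f → mk≈ λ m → ℤ.+-inverseʳ (f m))
        ; ⁻¹-cong = λ f≈g → mk≈ λ m → cong -ᶻ_ (at f≈g m) }
      ; comm = λ f g → mk≈ λ m → ℤ.+-comm (f m) (g m) }
    ; *-cong = ⊗-cong
    ; *-assoc = ⊗-assoc
    ; *-identity = ⊗-identityˡ , (λ f → ≈-trans (⊗-comm f one) (⊗-identityˡ f))
    ; distrib = ⊗-distribˡ-⊕
              , (λ f g h → ≈-trans (⊗-comm (g ⊕ h) f) (≈-trans (⊗-distribˡ-⊕ f g h)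
                             (⊕-cong′ (⊗-comm f g) (⊗-comm f h)))) }
  ; *-comm = ⊗-comm }
  where
  ⊕-cong′ : ∀ {f f′ g g′} → f ≈ f′ → g ≈ g′ → f ⊕ g ≈ f′ ⊕ g′
  ⊕-cong′ f≈f′ g≈g′ = mk≈ λ m → cong₂ _+ᶻ_ (at f≈f′ m) (at g≈g′ m)

⊕-⊗-commutativeRing : CommutativeRing 0ℓ 0ℓ
⊕-⊗-commutativeRing = record { isCommutativeRing = ⊕-⊗-isCommutativeRing }

open CommutativeRing ⊕-⊗-commutativeRing public
  using (setoid; zeroˡ; zeroʳ)
  renaming ( +-cong to ⊕-cong; +-assoc to ⊕-assoc; +-comm to ⊕-comm
           ; +-identityˡ to ⊕-identityˡ; +-identityʳ to ⊕-identityʳ; -‿cong to ⊝-cong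
           ; *-identityʳ to ⊗-identityʳ; distribʳ to ⊗-distribʳ-⊕)
open Algebra.Properties.Ring (CommutativeRing.ring ⊕-⊗-commutativeRing) public
  using () renaming (-‿distribˡ-* to ⊝-distribˡ-⊗; -‿distribʳ-* to ⊝-distribʳ-⊗; -‿involutive to ⊝-involutive)

module ≈-Reasoning = Relation.Binary.Reasoning.Setoid setoid

-- The ring solver embeds its integer coefficients by constant; since constant (+ 1) is
-- definitionally one, con (+ 1) stands for one in solver goals.
constant : ℤ → FPS
constant c m = if m ≡ᵇ 0 then c else + 0

private
  constant-homomorphism : ACR._-Raw-AlmostCommutative⟶_ (CommutativeRing.rawRing ℤ.+-*-commutativeRing)
                                                         (ACR.fromCommutativeRing ⊕-⊗-commutativeRing)
  constant-homomorphism = record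
    { ⟦_⟧    = constant
    ; +-homo = λ c d → mk≈ λ { zero → refl ; (suc m) → refl }
    ; *-homo = λ c d → mk≈ λ where
        zero    → refl
        (suc m) → sym (trans (sumUpTo-shift m _)
                   (cong₂ _+ᶻ_ (ℤ.*-zeroʳ c) (sumUpTo-zero m (λ j _ → ℤ.*-zeroˡ (constant d (m ∸ j))))))
    ; -‿homo = λ c → mk≈ λ { zero → refl ; (suc m) → refl }
    ; 0-homo = mk≈ λ { zero → refl ; (suc m) → refl }
    ; 1-homo = mk≈ λ { zero → refl ; (suc m) → refl } }

  constant-≟ : ∀ c d → Maybe (constant c ≈ constant d)
  constant-≟ c d with c ℤ.≟ d
  ... | yes refl = just ≈-refl
  ... | no _     = nothing

module ⊗-Solver = Algebra.Solver.Ring _ _ constant-homomorphism constant-≟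
open ⊗-Solver public using (solve; _:+_; _:*_; :-_; _:-_; _:=_; con)

private
  ≡ᵇ-+ : ∀ a d b → (a + d ≡ᵇ a + b) ≡ (d ≡ᵇ b)
  ≡ᵇ-+ zero    d b = refl
  ≡ᵇ-+ (suc a) d b = ≡ᵇ-+ a d b

qpow-< : ∀ {e m} → m < e → qpow e m ≡ + 0
qpow-< {e} {m} m<e with m ≡ᵇ e in eq
... | false = refl
... | true  = ⊥-elim (ℕ.<⇒≢ m<e (ℕ.≡ᵇ⇒≡ m e (subst T (sym eq) tt)))

qpow-cong : ∀ {a b} → a ≡ b → qpow a ≈ qpow b
qpow-cong a≡b = ≈-reflexive (cong qpow a≡b)

qpow-⊗-< : ∀ a f {m} → m < a → (qpow a ⊗ f) m ≡ + 0
qpow-⊗-< a f {m} m<a =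
  sumUpTo-zero m (λ j j≤m → cong (_*ᶻ f (m ∸ j)) (qpow-< (ℕ.≤-<-trans j≤m m<a)))

qpow-⊗-+ : ∀ a f d → (qpow a ⊗ f) (a + d) ≡ f d
qpow-⊗-+ zero    f d = at (⊗-identityˡ f) d
qpow-⊗-+ (suc a) f d = trans (sumUpTo-shift (a + d) _) (trans (ℤ.+-identityˡ _) (qpow-⊗-+ a f d))

qpow-+ : ∀ a b → qpow a ⊗ qpow b ≈ qpow (a + b)
qpow-+ a b = mk≈ coefficient
  where
  shifted : ∀ d → (qpow a ⊗ qpow b) (a + d) ≡ qpow (a + b) (a + d)
  shifted d = trans (qpow-⊗-+ a (qpow b) d) (cong (λ c → if c then + 1 else + 0) (sym (≡ᵇ-+ a d b)))
  coefficient : ∀ m → (qpow a ⊗ qpow b) m ≡ qpow (a + b) m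
  coefficient m with m <? a
  ... | yes m<a = trans (qpow-⊗-< a (qpow b) m<a) (sym (qpow-< (ℕ.<-≤-trans m<a (ℕ.m≤m+n a b))))
  ... | no  m≮a = subst (λ n → (qpow a ⊗ qpow b) n ≡ qpow (a + b) n)
                        (ℕ.m+[n∸m]≡n (ℕ.≮⇒≥ m≮a)) (shifted (m ∸ a))

qpow-^ : ∀ K l → qpow K ^ₛ l ≈ qpow (K * l)
qpow-^ K zero    = qpow-cong (sym (ℕ.*-zeroʳ K))
qpow-^ K (suc l) = ≈-trans (⊗-cong (qpow-^ K l) (≈-refl {qpow K}))
  (≈-trans (qpow-+ (K * l) K) (qpow-cong (trans (ℕ.+-comm (K * l) K) (sym (ℕ.*-suc K l)))))

±qpow : ℕ → ℕ → FPS
±qpow zero    e = qpow e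
±qpow (suc r) e = ⊝ ±qpow r e

±qpow-cong : ∀ r {a b} → a ≡ b → ±qpow r a ≈ ±qpow r b
±qpow-cong r a≡b = ≈-reflexive (cong (±qpow r) a≡b)

±qpow-⊗-qpow : ∀ r a b → ±qpow r a ⊗ qpow b ≈ ±qpow r (a + b)
±qpow-⊗-qpow zero    a b = qpow-+ a b
±qpow-⊗-qpow (suc r) a b = ≈-trans (≈-sym (⊝-distribˡ-⊗ (±qpow r a) (qpow b))) (⊝-cong (±qpow-⊗-qpow r a b))

qpow-⊗-±qpow : ∀ r a b → qpow a ⊗ ±qpow r b ≈ ±qpow r (a + b)
qpow-⊗-±qpow zero    a b = qpow-+ a b
qpow-⊗-±qpow (suc r) a b = ≈-trans (≈-sym (⊝-distribʳ-⊗ (qpow a) (±qpow r b))) (⊝-cong (qpow-⊗-±qpow r a b))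

infix 4 _≈[_]_
record _≈[_]_ (f : FPS) (L : ℕ) (g : FPS) : Set where
  constructor mk≈[]
  field at< : ∀ m → m < L → f m ≡ g m
open _≈[_]_ public

ord≥ : ℕ → FPS → Set
ord≥ d f = f ≈[ d ] 0ₛ

≈⇒≈[] : ∀ {f g} L → f ≈ g → f ≈[ L ] g
≈⇒≈[] L f≈g = mk≈[] λ m _ → at f≈g m

≈[]⇒≈ : ∀ {f g} → (∀ L → f ≈[ suc L ] g) → f ≈ g
≈[]⇒≈ agree = mk≈ λ m → at< (agree m) m ℕ.≤-refl

≈[]-refl : ∀ {f L} → f ≈[ L ] f
≈[]-refl = mk≈[] λ m _ → refl

≈[]-sym : ∀ {f g L} → f ≈[ L ] g → g ≈[ L ] f
≈[]-sym f≈g = mk≈[] λ m m<L → sym (at< f≈g m m<L)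

≈[]-trans : ∀ {f g h L} → f ≈[ L ] g → g ≈[ L ] h → f ≈[ L ] h
≈[]-trans f≈g g≈h = mk≈[] λ m m<L → trans (at< f≈g m m<L) (at< g≈h m m<L)

≈-≈[]-trans : ∀ {f g h L} → f ≈ g → g ≈[ L ] h → f ≈[ L ] h
≈-≈[]-trans f≈g = ≈[]-trans (≈⇒≈[] _ f≈g)

≈[]-≈-trans : ∀ {f g h L} → f ≈[ L ] g → g ≈ h → f ≈[ L ] h
≈[]-≈-trans f≈g g≈h = ≈[]-trans f≈g (≈⇒≈[] _ g≈h)

≈[]-mono : ∀ {f g L L′} → L′ ≤ L → f ≈[ L ] g → f ≈[ L′ ] g
≈[]-mono L′≤L f≈g = mk≈[] λ m m<L′ → at< f≈g m (ℕ.<-≤-trans m<L′ L′≤L)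

≈[]-⊕ : ∀ {f f′ g g′ L} → f ≈[ L ] f′ → g ≈[ L ] g′ → f ⊕ g ≈[ L ] f′ ⊕ g′
≈[]-⊕ f≈f′ g≈g′ = mk≈[] λ m m<L → cong₂ _+ᶻ_ (at< f≈f′ m m<L) (at< g≈g′ m m<L)

≈[]-⊝ : ∀ {f g L} → f ≈[ L ] g → ⊝ f ≈[ L ] ⊝ g
≈[]-⊝ f≈g = mk≈[] λ m m<L → cong -ᶻ_ (at< f≈g m m<L)

≈[]-⊗ : ∀ {f f′ g g′ L} → f ≈[ L ] f′ → g ≈[ L ] g′ → f ⊗ g ≈[ L ] f′ ⊗ g′
≈[]-⊗ f≈f′ g≈g′ = mk≈[] λ m m<L → sumUpTo-cong m λ j j≤m →
  cong₂ _*ᶻ_ (at< f≈f′ j (ℕ.≤-<-trans j≤m m<L)) (at< g≈g′ (m ∸ j) (ℕ.≤-<-trans (ℕ.m∸n≤m m j) m<L))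

≈[]-⊗-ord≥ : ∀ {s L h f g} → ord≥ s h → f ≈[ L ] g → h ⊗ f ≈[ s + L ] h ⊗ g
≈[]-⊗-ord≥ {s} {L} {h} {f} {g} h≈0 f≈g = mk≈[] λ m m<s+L → sumUpTo-cong m (term m m<s+L)
  where
  term : ∀ m → m < s + L → ∀ j → j ≤ m → h j *ᶻ f (m ∸ j) ≡ h j *ᶻ g (m ∸ j)
  term m m<s+L j j≤m with j <? s
  ... | yes j<s rewrite at< h≈0 j j<s = refl
  ... | no  j≮s = cong (h j *ᶻ_) (at< f≈g (m ∸ j) m∸j<L)
    where
    m∸j<L : m ∸ j < L
    m∸j<L = subst (_≤ L) (ℕ.+-∸-assoc 1 j≤m)
      (ℕ.m≤n+o⇒m∸n≤o (suc m) j (ℕ.≤-trans m<s+L (ℕ.+-monoˡ-≤ L (ℕ.≮⇒≥ j≮s))))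

ord≥-⊗ : ∀ {a b f g} → ord≥ a f → ord≥ b g → ord≥ (a + b) (f ⊗ g)
ord≥-⊗ {f = f} f≈0 g≈0 = ≈[]-≈-trans (≈[]-⊗-ord≥ f≈0 g≈0) (zeroʳ f)

ord≥-⊗ʳ : ∀ {a f} g → ord≥ a f → ord≥ a (f ⊗ g)
ord≥-⊗ʳ {a} {f} g f≈0 = subst (λ d → ord≥ d (f ⊗ g)) (ℕ.+-identityʳ a) (ord≥-⊗ {b = 0} {g = g} f≈0 (mk≈[] λ m ()))

ord≥-qpow : ∀ {d e} → d ≤ e → ord≥ d (qpow e)
ord≥-qpow d≤e = mk≈[] λ m m<d → qpow-< (ℕ.<-≤-trans m<d d≤e)

ord≥-±qpow : ∀ r {d e} → d ≤ e → ord≥ d (±qpow r e)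
ord≥-±qpow zero    d≤e = ord≥-qpow d≤e
ord≥-±qpow (suc r) d≤e = ≈[]-⊝ (ord≥-±qpow r d≤e)

-- The helper dot used by invRev is private to Defs; dot′ recovers it by unification from the
-- defining equation of invRev, once abstracting invRev f m and 0 puts that equation in pattern form.
mutual
  dot′ : FPS → ℕ → List ℤ → ℤ
  dot′ = _

  inv-suc : ∀ f m → inv f (suc m) ≡ -ᶻ dot′ f 0 (invRev f m)
  inv-suc f m with invRev f m | 0
  ... | bs | j = refl

dot′-invRev : ∀ f m j → dot′ f j (invRev f m) ≡ sumUpTo m (λ t → f (suc (j + t)) *ᶻ inv f (m ∸ t))
dot′-invRev f zero    j = trans (ℤ.+-identityʳ _) (cong (λ z → f (suc z) *ᶻ + 1) (sym (ℕ.+-identityʳ j)))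
dot′-invRev f (suc m) j = trans (cong (f (suc j) *ᶻ inv f (suc m) +ᶻ_) (dot′-invRev f m (suc j)))
  (sym (trans (sumUpTo-shift m _) (cong₂ _+ᶻ_ (cong (λ z → f (suc z) *ᶻ inv f (suc m)) (ℕ.+-identityʳ j))
     (sumUpTo-cong m (λ t _ → cong (λ z → f (suc z) *ᶻ inv f (m ∸ t)) (ℕ.+-suc j t))))))

record Unit (f : FPS) : Set where
  constructor mkUnit
  field constant-one : f 0 ≡ + 1
open Unit public

Unit-⊗ : ∀ {f g} → Unit f → Unit g → Unit (f ⊗ g)
Unit-⊗ u v = mkUnit (cong₂ _*ᶻ_ (constant-one u) (constant-one v))

Unit-cong : ∀ {f g} → f ≈ g → Unit f → Unit g
Unit-cong f≈g u = mkUnit (trans (sym (at f≈g 0)) (constant-one u))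

⊗-inverseʳ : ∀ {f} → Unit f → f ⊗ inv f ≈ one
⊗-inverseʳ {f} u = mk≈ coefficient
  where
  open ≡-Reasoning
  coefficient : ∀ m → (f ⊗ inv f) m ≡ one m
  coefficient zero    = cong (_*ᶻ + 1) (constant-one u)
  coefficient (suc m) = begin
    sumUpTo (suc m) (λ j → f j *ᶻ inv f (suc m ∸ j))  ≡⟨ sumUpTo-shift m _ ⟩
    f 0 *ᶻ inv f (suc m) +ᶻ S                          ≡⟨ cong (λ z → f 0 *ᶻ z +ᶻ S) (trans (inv-suc f m) (cong -ᶻ_ (dot′-invRev f m 0))) ⟩
    f 0 *ᶻ (-ᶻ S) +ᶻ S                                 ≡⟨ cong (λ z → z *ᶻ (-ᶻ S) +ᶻ S) (constant-one u) ⟩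
    + 1 *ᶻ (-ᶻ S) +ᶻ S                                 ≡⟨ cong (_+ᶻ S) (ℤ.*-identityˡ (-ᶻ S)) ⟩
    -ᶻ S +ᶻ S                                          ≡⟨ ℤ.+-inverseˡ S ⟩
    + 0                                                ∎
    where
    S : ℤ
    S = sumUpTo m (λ t → f (suc t) *ᶻ inv f (m ∸ t))

⊗-inverseˡ : ∀ {f} → Unit f → inv f ⊗ f ≈ one
⊗-inverseˡ {f} u = ≈-trans (⊗-comm (inv f) f) (⊗-inverseʳ u)

quotient-≈ : ∀ {f g d} → Unit d → f ≈ g ⊗ d → f ⊗ inv d ≈ g
quotient-≈ {f} {g} {d} u f≈gd = begin
  f ⊗ inv d        ≈⟨ ⊗-cong f≈gd (≈-refl {inv d}) ⟩
  g ⊗ d ⊗ inv d    ≈⟨ ⊗-assoc g d (inv d) ⟩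
  g ⊗ (d ⊗ inv d)  ≈⟨ ⊗-cong (≈-refl {g}) (⊗-inverseʳ u) ⟩
  g ⊗ one          ≈⟨ ⊗-identityʳ g ⟩
  g                ∎
  where open ≈-Reasoning

⊗-cancelʳ : ∀ {f g h} → Unit h → f ⊗ h ≈ g ⊗ h → f ≈ g
⊗-cancelʳ {f} {h = h} u fh≈gh = ≈-trans (≈-sym (quotient-≈ u (≈-refl {f ⊗ h}))) (quotient-≈ u fh≈gh)

inv-cong : ∀ {f g} → Unit f → Unit g → f ≈ g → inv f ≈ inv g
inv-cong {f} {g} u v f≈g = ⊗-cancelʳ u (≈-trans (⊗-inverseˡ u)
  (≈-sym (≈-trans (⊗-cong (≈-refl {inv g}) f≈g) (⊗-inverseˡ v))))

inv-⊗ : ∀ {f g} → Unit f → Unit g → inv (f ⊗ g) ≈ inv f ⊗ inv g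
inv-⊗ {f} {g} u v = ⊗-cancelʳ (Unit-⊗ u v) (≈-trans (⊗-inverseˡ (Unit-⊗ u v)) (≈-sym (begin
  inv f ⊗ inv g ⊗ (f ⊗ g)    ≈⟨ solve 4 (λ a b c d → a :* b :* (c :* d) := (a :* c) :* (b :* d)) ≈-refl (inv f) (inv g) f g ⟩
  (inv f ⊗ f) ⊗ (inv g ⊗ g)  ≈⟨ ⊗-cong (⊗-inverseˡ u) (⊗-inverseˡ v) ⟩
  one ⊗ one                  ≈⟨ ⊗-identityˡ one ⟩
  one                        ∎)))
  where open ≈-Reasoning

fsum : ℕ → (ℕ → FPS) → FPS
fsum zero    F = 0ₛ
fsum (suc n) F = fsum n F ⊕ F n

fsum-cong : ∀ n {F G} → (∀ t → t < n → F t ≈ G t) → fsum n F ≈ fsum n G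
fsum-cong zero    F≈G = ≈-refl
fsum-cong (suc n) F≈G = ⊕-cong (fsum-cong n (λ t t<n → F≈G t (ℕ.m≤n⇒m≤1+n t<n))) (F≈G n ℕ.≤-refl)

≈[]-fsum : ∀ n {F G L} → (∀ t → t < n → F t ≈[ L ] G t) → fsum n F ≈[ L ] fsum n G
≈[]-fsum zero    F≈G = ≈[]-refl
≈[]-fsum (suc n) F≈G = ≈[]-⊕ (≈[]-fsum n (λ t t<n → F≈G t (ℕ.m≤n⇒m≤1+n t<n))) (F≈G n ℕ.≤-refl)

fsum-⊕ : ∀ n F G → fsum n (λ t → F t ⊕ G t) ≈ fsum n F ⊕ fsum n G
fsum-⊕ zero    F G = ≈-sym (⊕-identityˡ 0ₛ)
fsum-⊕ (suc n) F G = ≈-trans (⊕-cong (fsum-⊕ n F G) (≈-refl {F n ⊕ G n}))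
  (solve 4 (λ a b c d → (a :+ b) :+ (c :+ d) := (a :+ c) :+ (b :+ d)) ≈-refl (fsum n F) (fsum n G) (F n) (G n))

fsum-⊝ : ∀ n F → fsum n (λ t → ⊝ F t) ≈ ⊝ fsum n F
fsum-⊝ zero    F = mk≈ λ m → refl
fsum-⊝ (suc n) F = ≈-trans (⊕-cong (fsum-⊝ n F) (≈-refl {⊝ F n}))
  (solve 2 (λ a b → (:- a) :+ (:- b) := :- (a :+ b)) ≈-refl (fsum n F) (F n))

fsum-⊗ʳ : ∀ n F g → fsum n F ⊗ g ≈ fsum n (λ t → F t ⊗ g)
fsum-⊗ʳ zero    F g = zeroˡ g
fsum-⊗ʳ (suc n) F g = ≈-trans (⊗-distribʳ-⊕ g (fsum n F) (F n)) (⊕-cong (fsum-⊗ʳ n F g) ≈-refl)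

fsum-⊗ˡ : ∀ n F g → g ⊗ fsum n F ≈ fsum n (λ t → g ⊗ F t)
fsum-⊗ˡ n F g = ≈-trans (⊗-comm g (fsum n F))
  (≈-trans (fsum-⊗ʳ n F g) (fsum-cong n (λ t _ → ⊗-comm (F t) g)))

fsum-shift : ∀ n F → fsum (suc n) F ≈ F 0 ⊕ fsum n (λ t → F (suc t))
fsum-shift zero    F = ≈-trans (⊕-identityˡ (F 0)) (≈-sym (⊕-identityʳ (F 0)))
fsum-shift (suc n) F = ≈-trans (⊕-cong (fsum-shift n F) (≈-refl {F (suc n)}))
  (⊕-assoc (F 0) (fsum n (λ t → F (suc t))) (F (suc n)))

fsum-unshift : ∀ n F → F n ≈ 0ₛ → fsum n (λ t → F (suc t)) ≈ fsum n F ⊕ ⊝ F 0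
fsum-unshift n F Fn≈0 = begin
    fsum n (λ t → F (suc t))
  ≈⟨ solve 2 (λ a b → b := a :+ b :+ (:- a)) ≈-refl (F 0) (fsum n (λ t → F (suc t))) ⟩
    F 0 ⊕ fsum n (λ t → F (suc t)) ⊕ ⊝ F 0
  ≈⟨ ⊕-cong (≈-sym (fsum-shift n F)) (≈-refl {⊝ F 0}) ⟩
    fsum n F ⊕ F n ⊕ ⊝ F 0
  ≈⟨ ⊕-cong (≈-trans (⊕-cong (≈-refl {fsum n F}) Fn≈0) (⊕-identityʳ (fsum n F))) (≈-refl {⊝ F 0}) ⟩
    fsum n F ⊕ ⊝ F 0
  ∎
  where open ≈-Reasoning

fsum-at : ∀ m F m′ → fsum (suc m) F m′ ≡ sumUpTo m (λ t → F t m′)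
fsum-at zero    F m′ = ℤ.+-identityˡ (F 0 m′)
fsum-at (suc m) F m′ = cong (_+ᶻ F (suc m) m′) (fsum-at m F m′)

fsum-extend : ∀ a b (G : ℕ → FPS) m → a ≤ b → (∀ σ → a ≤ σ → σ < b → G σ m ≡ + 0) →
  fsum b G m ≡ fsum a G m
fsum-extend a zero    G m z≤n vanish = refl
fsum-extend a (suc b) G m a≤b vanish with ℕ.m≤n⇒m<n∨m≡n a≤b
... | inj₂ refl        = refl
... | inj₁ (s≤s a≤b′) =
  trans (cong₂ _+ᶻ_ (fsum-extend a b G m a≤b′ (λ σ a≤σ σ<b → vanish σ a≤σ (ℕ.m≤n⇒m≤1+n σ<b)))
                    (vanish b a≤b′ ℕ.≤-refl))
        (ℤ.+-identityʳ _)

-- sumInf T ignores the coefficients of T n below degree n, so it is the sum of T only when T n = O(q^n).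
Summable : (ℕ → FPS) → Set
Summable T = ∀ n → ord≥ n (T n)

sumInf-cong : ∀ {T U} → (∀ n → T n ≈ U n) → sumInf T ≈ sumInf U
sumInf-cong T≈U = mk≈ λ m → sumUpTo-cong m (λ n _ → at (T≈U n) m)

sumInf-⊕ : ∀ T U → sumInf (λ n → T n ⊕ U n) ≈ sumInf T ⊕ sumInf U
sumInf-⊕ T U = mk≈ λ m → sumUpTo-+ m (λ n → T n m) (λ n → U n m)

sumInf-swap : ∀ (H : ℕ → ℕ → FPS) → sumInf (λ n → sumInf (H n)) ≈ sumInf (λ r → sumInf (λ n → H n r))
sumInf-swap H = mk≈ λ m → sumUpTo-swap m m (λ n r → H n r m)

sumInf-≈[]-fsum : ∀ {T} → Summable T → ∀ L → sumInf T ≈[ suc L ] fsum (suc L) T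
sumInf-≈[]-fsum {T} summable L = mk≈[] λ m m≤L → sym (trans (fsum-at L T m)
  (sumUpTo-extend L m (λ n → T n m) (ℕ.≤-pred m≤L) (λ n m<n _ → at< (summable n) m m<n)))

sumInf-⊗ʳ : ∀ {T} → Summable T → ∀ g → sumInf T ⊗ g ≈ sumInf (λ n → T n ⊗ g)
sumInf-⊗ʳ {T} summable g = ≈[]⇒≈ λ L →
  ≈[]-trans (≈[]-⊗ (sumInf-≈[]-fsum summable L) (≈[]-refl {g}))
  (≈-≈[]-trans (fsum-⊗ʳ (suc L) T g) (≈[]-sym (sumInf-≈[]-fsum (λ n → ord≥-⊗ʳ g (summable n)) L)))

sumInf-⊗ˡ : ∀ {T} → Summable T → ∀ g → g ⊗ sumInf T ≈ sumInf (λ n → g ⊗ T n)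
sumInf-⊗ˡ {T} summable g = ≈-trans (⊗-comm g (sumInf T))
  (≈-trans (sumInf-⊗ʳ summable g) (sumInf-cong (λ n → ⊗-comm (T n) g)))

sumInf-shift : ∀ {Z} c → Summable Z → (∀ n → n < c → Z n ≈ 0ₛ) → sumInf Z ≈ sumInf (λ s → Z (c + s))
sumInf-shift zero    summable vanish = ≈-refl
sumInf-shift {Z} (suc c) summable vanish =
  ≈-trans (sumInf-shift c summable (λ n n<c → vanish n (ℕ.m≤n⇒m≤1+n n<c)))
  (≈-trans (dropFirst (λ n → ≈[]-mono (ℕ.m≤n+m n c) (summable (c + n)))
                      (≈-trans (≈-reflexive (cong Z (ℕ.+-identityʳ c))) (vanish c ℕ.≤-refl)))
           (sumInf-cong (λ s → ≈-reflexive (cong Z (ℕ.+-suc c s)))))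
  where
  dropFirst : ∀ {Y} → Summable Y → Y 0 ≈ 0ₛ → sumInf Y ≈ sumInf (λ s → Y (suc s))
  dropFirst {Y} summableY Y0≈0 = mk≈ coefficient
    where
    coefficient : ∀ m → sumInf Y m ≡ sumInf (λ s → Y (suc s)) m
    coefficient zero    = trans (at Y0≈0 0) (sym (at< (summableY 1) 0 (s≤s z≤n)))
    coefficient (suc m) = let S = sumUpTo m (λ n → Y (suc n) (suc m)) in
      trans (sumUpTo-shift m (λ n → Y n (suc m)))
      (trans (cong (_+ᶻ S) (at Y0≈0 (suc m)))
      (trans (ℤ.+-identityˡ S)
      (sym (trans (cong (S +ᶻ_) (at< (summableY (suc (suc m))) (suc m) ℕ.≤-refl)) (ℤ.+-identityʳ S)))))

fsum-≈-sumInf : ∀ {H} v → Summable H → (∀ σ → v ≤ σ → H σ ≈ 0ₛ) → fsum v H ≈ sumInf H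
fsum-≈-sumInf {H} v summable vanish = mk≈ coefficient
  where
  coefficient : ∀ m → fsum v H m ≡ sumInf H m
  coefficient m with ℕ.≤-total v (suc m)
  ... | inj₁ v≤1+m = trans (sym (fsum-extend v (suc m) H m v≤1+m (λ σ v≤σ _ → at (vanish σ v≤σ) m)))
                           (fsum-at m H m)
  ... | inj₂ 1+m≤v = trans (fsum-extend (suc m) v H m 1+m≤v (λ σ m<σ _ → at< (summable σ) m m<σ))
                           (fsum-at m H m)

infixl 5 _↾_
_↾_ : (ℕ → FPS) → ℕ → ℕ → FPS
(G ↾ v) σ with σ <? v
... | yes _ = G σ
... | no  _ = 0ₛ

↾-< : ∀ G {v σ} → σ < v → (G ↾ v) σ ≈ G σ
↾-< G {v} {σ} σ<v with σ <? v
... | yes _   = ≈-refl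
... | no σ≮v = ⊥-elim (σ≮v σ<v)

↾-≥ : ∀ G {v σ} → v ≤ σ → (G ↾ v) σ ≈ 0ₛ
↾-≥ G {v} {σ} v≤σ with σ <? v
... | yes σ<v = ⊥-elim (ℕ.<⇒≱ σ<v v≤σ)
... | no _    = ≈-refl

↾-⊗ˡ : ∀ (f G : ℕ → FPS) v σ → ((λ τ → f τ ⊗ G τ) ↾ v) σ ≈ f σ ⊗ (G ↾ v) σ
↾-⊗ˡ f G v σ with σ <? v
... | yes _ = ≈-refl {f σ ⊗ G σ}
... | no _  = ≈-sym (zeroʳ (f σ))

ord≥-↾ : ∀ {d} G v σ → ord≥ d (G σ) → ord≥ d ((G ↾ v) σ)
ord≥-↾ G v σ G≈0 with σ <? v
... | yes _ = G≈0
... | no _  = ≈[]-refl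

fsum-≈-sumInf-↾ : ∀ {G} v → Summable G → fsum v G ≈ sumInf (G ↾ v)
fsum-≈-sumInf-↾ {G} v summable = ≈-trans (fsum-cong v (λ σ σ<v → ≈-sym (↾-< G σ<v)))
  (fsum-≈-sumInf v (λ σ → ord≥-↾ G v σ (summable σ)) (λ σ v≤σ → ↾-≥ G v≤σ))

-- q-Pochhammer symbols (q^e; q^K)_n

qPoch : ℕ → ℕ → ℕ → FPS
qPoch e K n = prodBelow n (λ l → one ⊖ qpow (e + K * l))

qPoch∞ : ℕ → ℕ → FPS
qPoch∞ e K = pochInf (qpow e) (qpow K)

poch-qpow : ∀ e K n → poch (qpow e) (qpow K) n ≈ qPoch e K n
poch-qpow e K zero    = ≈-refl
poch-qpow e K (suc n) = ⊗-cong (poch-qpow e K n)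
  (⊕-cong (≈-refl {one}) (⊝-cong (≈-trans (⊗-cong (≈-refl {qpow e}) (qpow-^ K n)) (qpow-+ e (K * n)))))

Unit-qPoch : ∀ e K n → 1 ≤ e → Unit (qPoch e K n)
Unit-qPoch e K zero    1≤e = mkUnit refl
Unit-qPoch e K (suc n) 1≤e = Unit-⊗ {qPoch e K n} (Unit-qPoch e K n 1≤e) (factor (ℕ.≤-trans 1≤e (ℕ.m≤m+n e (K * n))))
  where
  factor : ∀ {x} → 1 ≤ x → Unit (one ⊖ qpow x)
  factor {suc x} _ = mkUnit refl

qPoch-+ : ∀ e K a b → qPoch e K (a + b) ≈ qPoch e K a ⊗ qPoch (e + K * a) K b
qPoch-+ e K a zero    = ≈-trans (≈-reflexive (cong (qPoch e K) (ℕ.+-identityʳ a))) (≈-sym (⊗-identityʳ (qPoch e K a)))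
qPoch-+ e K a (suc b) = begin
    qPoch e K (a + suc b)
  ≈⟨ ≈-reflexive (cong (qPoch e K) (ℕ.+-suc a b)) ⟩
    qPoch e K (a + b) ⊗ (one ⊖ qpow (e + K * (a + b)))
  ≈⟨ ⊗-cong (qPoch-+ e K a b) (⊕-cong (≈-refl {one}) (⊝-cong (qpow-cong (exponent e K a b)))) ⟩
    qPoch e K a ⊗ qPoch (e + K * a) K b ⊗ (one ⊖ qpow (e + K * a + K * b))
  ≈⟨ ⊗-assoc (qPoch e K a) (qPoch (e + K * a) K b) (one ⊖ qpow (e + K * a + K * b)) ⟩
    qPoch e K a ⊗ qPoch (e + K * a) K (suc b)
  ∎
  where
  open ≈-Reasoning
  exponent : ∀ e K a b → e + K * (a + b) ≡ e + K * a + K * b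
  exponent = ℕ-Solver.solve-∀

qPoch-sucˡ : ∀ e K n → qPoch e K (suc n) ≈ (one ⊖ qpow e) ⊗ qPoch (e + K) K n
qPoch-sucˡ e K n = ≈-trans (qPoch-+ e K 1 n)
  (⊗-cong (≈-trans (⊗-identityˡ _) (⊕-cong (≈-refl {one}) (⊝-cong (qpow-cong (trans (cong (λ z → e + z) (ℕ.*-zeroʳ K)) (ℕ.+-identityʳ e))))))
          (≈-reflexive (cong (λ z → qPoch (e + z) K n) (ℕ.*-identityʳ K))))

qPoch-≈[]-one : ∀ c K b → qPoch c K b ≈[ c ] one
qPoch-≈[]-one c K zero    = ≈[]-refl
qPoch-≈[]-one c K (suc b) = ≈[]-≈-trans (≈[]-⊗ (qPoch-≈[]-one c K b) factor≈1) (⊗-identityˡ one)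
  where
  factor≈1 : one ⊖ qpow (c + K * b) ≈[ c ] one
  factor≈1 = mk≈[] λ m m<c →
    trans (cong (λ z → one m -ᶻ z) (qpow-< (ℕ.<-≤-trans m<c (ℕ.m≤m+n c (K * b))))) (ℤ.+-identityʳ (one m))

n<1+K*n : ∀ {K} n → 1 ≤ K → n < suc (K * n)
n<1+K*n {K} n 1≤K = s≤s (ℕ.≤-trans (ℕ.≤-reflexive (sym (ℕ.*-identityˡ n))) (ℕ.*-monoˡ-≤ n 1≤K))

qPoch-stable : ∀ e K n d → 1 ≤ e → 1 ≤ K → qPoch e K (n + d) ≈[ suc n ] qPoch e K n
qPoch-stable e K n d 1≤e 1≤K = ≈-≈[]-trans (qPoch-+ e K n d)
  (≈[]-≈-trans (≈[]-⊗ (≈[]-refl {qPoch e K n}) (≈[]-mono n<e+Kn (qPoch-≈[]-one (e + K * n) K d)))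
               (⊗-identityʳ (qPoch e K n)))
  where
  n<e+Kn : suc n ≤ e + K * n
  n<e+Kn = ℕ.+-mono-≤ 1≤e (ℕ.≤-pred (n<1+K*n n 1≤K))

qPoch∞-≈[]-qPoch : ∀ e K → 1 ≤ e → 1 ≤ K → ∀ n → qPoch∞ e K ≈[ suc n ] qPoch e K n
qPoch∞-≈[]-qPoch e K 1≤e 1≤K n = mk≈[] coefficient
  where
  open ≡-Reasoning
  coefficient : ∀ m → m < suc n → qPoch∞ e K m ≡ qPoch e K n m
  coefficient m (s≤s m≤n) = begin
    poch (qpow e) (qpow K) (suc m) m    ≡⟨ at (poch-qpow e K (suc m)) m ⟩
    qPoch e K (suc m) m                 ≡⟨ cong (λ z → qPoch e K z m) (ℕ.+-comm 1 m) ⟩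
    qPoch e K (m + 1) m                 ≡⟨ at< (qPoch-stable e K m 1 1≤e 1≤K) m ℕ.≤-refl ⟩
    qPoch e K m m                       ≡⟨ sym (at< (qPoch-stable e K m (n ∸ m) 1≤e 1≤K) m ℕ.≤-refl) ⟩
    qPoch e K (m + (n ∸ m)) m           ≡⟨ cong (λ z → qPoch e K z m) (ℕ.m+[n∸m]≡n m≤n) ⟩
    qPoch e K n m                       ∎

Unit-qPoch∞ : ∀ e K → 1 ≤ e → Unit (qPoch∞ e K)
Unit-qPoch∞ e K 1≤e = mkUnit (trans (at (poch-qpow e K 1) 0) (constant-one (Unit-qPoch e K 1 1≤e)))

qPoch∞-split : ∀ e K → 1 ≤ e → 1 ≤ K → ∀ a → qPoch∞ e K ≈ qPoch e K a ⊗ qPoch∞ (e + K * a) K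
qPoch∞-split e K 1≤e 1≤K a = ≈[]⇒≈ λ L →
  ≈[]-trans (≈[]-mono (s≤s (ℕ.m≤n+m L a)) (qPoch∞-≈[]-qPoch e K 1≤e 1≤K (a + L)))
  (≈-≈[]-trans (qPoch-+ e K a L)
  (≈[]-⊗ (≈[]-refl {qPoch e K a})
         (≈[]-sym (qPoch∞-≈[]-qPoch (e + K * a) K (ℕ.≤-trans 1≤e (ℕ.m≤m+n e (K * a))) 1≤K L))))

qPoch∞-≈[]-one : ∀ c K → 1 ≤ c → 1 ≤ K → qPoch∞ c K ≈[ c ] one
qPoch∞-≈[]-one c K 1≤c 1≤K =
  ≈[]-trans (≈[]-mono (ℕ.n≤1+n c) (qPoch∞-≈[]-qPoch c K 1≤c 1≤K c)) (qPoch-≈[]-one c K c)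

-- Gaussian binomial coefficients in base q^K

module GaussianBinomial (K : ℕ) (1≤K : 1 ≤ K) where

  qBinom : ℕ → ℕ → FPS
  qBinom zero    zero    = one
  qBinom zero    (suc t) = 0ₛ
  qBinom (suc N) zero    = one
  qBinom (suc N) (suc t) = qBinom N t ⊕ qpow (K * suc t) ⊗ qBinom N (suc t)

  qFact : ℕ → FPS
  qFact n = qPoch K K n

  Unit-qFact : ∀ n → Unit (qFact n)
  Unit-qFact n = Unit-qPoch K K n 1≤K

  qBinom-zeroʳ : ∀ N → qBinom N 0 ≈ one
  qBinom-zeroʳ zero    = ≈-refl
  qBinom-zeroʳ (suc N) = ≈-refl

  qBinom-> : ∀ N t → N < t → qBinom N t ≈ 0ₛ
  qBinom-> zero    (suc t) _         = ≈-refl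
  qBinom-> (suc N) (suc t) (s≤s N<t) = ≈-trans
    (⊕-cong (qBinom-> N t N<t) (≈-trans (⊗-cong (≈-refl {qpow (K * suc t)}) (qBinom-> N (suc t) (ℕ.m≤n⇒m≤1+n N<t)))
                                        (zeroʳ (qpow (K * suc t)))))
    (⊕-identityˡ 0ₛ)

  qFact-suc : ∀ n → qFact (suc n) ≈ qFact n ⊗ (one ⊖ qpow (K * suc n))
  qFact-suc n = ⊗-cong (≈-refl {qFact n}) (⊕-cong (≈-refl {one}) (⊝-cong (qpow-cong (sym (ℕ.*-suc K n)))))

  private
    qFact-∸ : ∀ N t → t < N → qFact (N ∸ t) ≈ qFact (N ∸ suc t) ⊗ (one ⊖ qpow (K * (N ∸ t)))
    qFact-∸ N t t<N = ≈-trans (≈-reflexive (cong qFact (∸-suc t<N)))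
      (≈-trans (qFact-suc (N ∸ suc t)) (⊗-cong (≈-refl {qFact (N ∸ suc t)}) (⊕-cong (≈-refl {one})
        (⊝-cong (qpow-cong (cong (λ z → K * z) (sym (∸-suc t<N))))))))
      where
      ∸-suc : ∀ {N t} → t < N → N ∸ t ≡ suc (N ∸ suc t)
      ∸-suc {suc N} {zero}  _         = refl
      ∸-suc {suc N} {suc t} (s≤s t<N) = ∸-suc t<N

    qpow-K-+ : ∀ N t → t < N → qpow (K * suc t) ⊗ qpow (K * (N ∸ t)) ≈ qpow (K * suc N)
    qpow-K-+ N t t<N = ≈-trans (qpow-+ (K * suc t) (K * (N ∸ t)))
      (qpow-cong (trans (sym (ℕ.*-distribˡ-+ K (suc t) (N ∸ t)))
                        (cong (λ z → K * suc z) (ℕ.m+[n∸m]≡n (ℕ.<⇒≤ t<N)))))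

  qBinom-product-step : ∀ N t → t < N →
    qBinom N t ⊗ (qFact t ⊗ qFact (N ∸ t)) ≈ qFact N →
    qBinom N (suc t) ⊗ (qFact (suc t) ⊗ qFact (N ∸ suc t)) ≈ qFact N →
    qBinom (suc N) (suc t) ⊗ (qFact (suc t) ⊗ qFact (N ∸ t)) ≈ qFact (suc N)
  qBinom-product-step N t t<N left right = begin
      (a ⊕ x ⊗ b) ⊗ (qFact (suc t) ⊗ qFact (N ∸ t))
    ≈⟨ ⊗-cong (≈-refl {a ⊕ x ⊗ b}) (⊗-cong (qFact-suc t) (qFact-∸ N t t<N)) ⟩
      (a ⊕ x ⊗ b) ⊗ (qFact t ⊗ (one ⊖ x) ⊗ (e ⊗ (one ⊖ y)))
    ≈⟨ solve 6 (λ a b c e x y → (a :+ x :* b) :* (c :* (con (+ 1) :- x) :* (e :* (con (+ 1) :- y)))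
                := (con (+ 1) :- x) :* (a :* (c :* (e :* (con (+ 1) :- y))))
                   :+ x :* (con (+ 1) :- y) :* (b :* (c :* (con (+ 1) :- x) :* e))) ≈-refl a b (qFact t) e x y ⟩
      (one ⊖ x) ⊗ (a ⊗ (qFact t ⊗ (e ⊗ (one ⊖ y)))) ⊕ x ⊗ (one ⊖ y) ⊗ (b ⊗ (qFact t ⊗ (one ⊖ x) ⊗ e))
    ≈⟨ ⊕-cong (⊗-cong (≈-refl {one ⊖ x}) (≈-trans (⊗-cong (≈-refl {a}) (⊗-cong (≈-refl {qFact t}) (≈-sym (qFact-∸ N t t<N)))) left))
              (⊗-cong (≈-refl {x ⊗ (one ⊖ y)}) (≈-trans (⊗-cong (≈-refl {b}) (⊗-cong (≈-sym (qFact-suc t)) (≈-refl {e}))) right)) ⟩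
      (one ⊖ x) ⊗ qFact N ⊕ x ⊗ (one ⊖ y) ⊗ qFact N
    ≈⟨ solve 3 (λ p x y → (con (+ 1) :- x) :* p :+ x :* (con (+ 1) :- y) :* p := p :* (con (+ 1) :- x :* y)) ≈-refl (qFact N) x y ⟩
      qFact N ⊗ (one ⊖ x ⊗ y)
    ≈⟨ ⊗-cong (≈-refl {qFact N}) (⊕-cong (≈-refl {one}) (⊝-cong (qpow-K-+ N t t<N))) ⟩
      qFact N ⊗ (one ⊖ qpow (K * suc N))
    ≈⟨ ≈-sym (qFact-suc N) ⟩
      qFact (suc N)
    ∎
    where
    open ≈-Reasoning
    a b e x y : FPS
    a = qBinom N t
    b = qBinom N (suc t)
    e = qFact (N ∸ suc t)
    x = qpow (K * suc t)
    y = qpow (K * (N ∸ t))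

  qBinom-product : ∀ N t → t ≤ N → qBinom N t ⊗ (qFact t ⊗ qFact (N ∸ t)) ≈ qFact N
  qBinom-product zero    zero    _ = ≈-trans (⊗-identityˡ (one ⊗ one)) (⊗-identityˡ one)
  qBinom-product (suc N) zero    _ = ≈-trans (⊗-identityˡ (one ⊗ qFact (suc N))) (⊗-identityˡ (qFact (suc N)))
  qBinom-product (suc N) (suc t) (s≤s t≤N) with ℕ.m≤n⇒m<n∨m≡n t≤N
  ... | inj₁ t<N = qBinom-product-step N t t<N (qBinom-product N t t≤N) (qBinom-product N (suc t) t<N)
  ... | inj₂ refl = begin
      (qBinom t t ⊕ x ⊗ qBinom t (suc t)) ⊗ (qFact (suc t) ⊗ qFact (t ∸ t))
    ≈⟨ ⊗-cong (≈-trans (⊕-cong (≈-refl {qBinom t t}) (≈-trans (⊗-cong (≈-refl {x}) (qBinom-> t (suc t) ℕ.≤-refl)) (zeroʳ x)))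
                       (⊕-identityʳ (qBinom t t)))
              (⊗-cong (qFact-suc t) (≈-refl {qFact (t ∸ t)})) ⟩
      qBinom t t ⊗ (qFact t ⊗ (one ⊖ x) ⊗ qFact (t ∸ t))
    ≈⟨ solve 4 (λ a c x d → a :* (c :* (con (+ 1) :- x) :* d) := a :* (c :* d) :* (con (+ 1) :- x))
             ≈-refl (qBinom t t) (qFact t) x (qFact (t ∸ t)) ⟩
      qBinom t t ⊗ (qFact t ⊗ qFact (t ∸ t)) ⊗ (one ⊖ x)
    ≈⟨ ⊗-cong (qBinom-product t t ℕ.≤-refl) (≈-refl {one ⊖ x}) ⟩
      qFact t ⊗ (one ⊖ x)
    ≈⟨ ≈-sym (qFact-suc t) ⟩
      qFact (suc t)
    ∎
    where
    open ≈-Reasoning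
    x : FPS
    x = qpow (K * suc t)

  qBinom-ratio : ∀ N t → t < N →
    qBinom N t ⊗ (one ⊖ qpow (K * (N ∸ t))) ≈ qBinom N (suc t) ⊗ (one ⊖ qpow (K * suc t))
  qBinom-ratio N t t<N = ⊗-cancelʳ (Unit-⊗ (Unit-qFact t) (Unit-qFact (N ∸ suc t))) (begin
      qBinom N t ⊗ (one ⊖ y) ⊗ (qFact t ⊗ e)
    ≈⟨ solve 4 (λ a y c e → a :* (con (+ 1) :- y) :* (c :* e) := a :* (c :* (e :* (con (+ 1) :- y)))) ≈-refl (qBinom N t) y (qFact t) e ⟩
      qBinom N t ⊗ (qFact t ⊗ (e ⊗ (one ⊖ y)))
    ≈⟨ ⊗-cong (≈-refl {qBinom N t}) (⊗-cong (≈-refl {qFact t}) (≈-sym (qFact-∸ N t t<N))) ⟩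
      qBinom N t ⊗ (qFact t ⊗ qFact (N ∸ t))
    ≈⟨ qBinom-product N t (ℕ.<⇒≤ t<N) ⟩
      qFact N
    ≈⟨ ≈-sym (qBinom-product N (suc t) t<N) ⟩
      qBinom N (suc t) ⊗ (qFact (suc t) ⊗ e)
    ≈⟨ ⊗-cong (≈-refl {qBinom N (suc t)}) (⊗-cong (qFact-suc t) (≈-refl {e})) ⟩
      qBinom N (suc t) ⊗ (qFact t ⊗ (one ⊖ x) ⊗ e)
    ≈⟨ solve 4 (λ b x c e → b :* (c :* (con (+ 1) :- x) :* e) := b :* (con (+ 1) :- x) :* (c :* e)) ≈-refl (qBinom N (suc t)) x (qFact t) e ⟩
      qBinom N (suc t) ⊗ (one ⊖ x) ⊗ (qFact t ⊗ e)
    ∎)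
    where
    open ≈-Reasoning
    e x y : FPS
    e = qFact (N ∸ suc t)
    x = qpow (K * suc t)
    y = qpow (K * (N ∸ t))

  qBinom-pascal′ : ∀ N t → t ≤ N → qBinom (suc N) (suc t) ≈ qBinom N (suc t) ⊕ qpow (K * (N ∸ t)) ⊗ qBinom N t
  qBinom-pascal′ N t t≤N with ℕ.m≤n⇒m<n∨m≡n t≤N
  ... | inj₁ t<N = begin
      a ⊕ x ⊗ b
    ≈⟨ solve 4 (λ a b x y → a :+ x :* b := b :+ y :* a :+ (a :* (con (+ 1) :- y) :- b :* (con (+ 1) :- x))) ≈-refl a b x y ⟩
      b ⊕ y ⊗ a ⊕ (a ⊗ (one ⊖ y) ⊕ ⊝ (b ⊗ (one ⊖ x)))
    ≈⟨ ⊕-cong (≈-refl {b ⊕ y ⊗ a}) (⊕-cong (qBinom-ratio N t t<N) (≈-refl {⊝ (b ⊗ (one ⊖ x))})) ⟩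
      b ⊕ y ⊗ a ⊕ (b ⊗ (one ⊖ x) ⊕ ⊝ (b ⊗ (one ⊖ x)))
    ≈⟨ solve 3 (λ a b c → a :+ (c :+ (:- c)) := a) ≈-refl (b ⊕ y ⊗ a) b (b ⊗ (one ⊖ x)) ⟩
      b ⊕ y ⊗ a
    ∎
    where
    open ≈-Reasoning
    a b x y : FPS
    a = qBinom N t
    b = qBinom N (suc t)
    x = qpow (K * suc t)
    y = qpow (K * (N ∸ t))
  ... | inj₂ refl = begin
      qBinom t t ⊕ qpow (K * suc t) ⊗ qBinom t (suc t)
    ≈⟨ ⊕-cong (≈-sym (⊗-identityˡ (qBinom t t))) (≈-trans (⊗-cong (≈-refl {qpow (K * suc t)}) (qBinom-> t (suc t) ℕ.≤-refl)) (zeroʳ (qpow (K * suc t)))) ⟩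
      one ⊗ qBinom t t ⊕ 0ₛ
    ≈⟨ ≈-trans (⊕-comm (one ⊗ qBinom t t) 0ₛ) (⊕-cong (≈-sym (qBinom-> t (suc t) ℕ.≤-refl))
                                     (⊗-cong (qpow-cong (sym (trans (cong (λ z → K * z) (ℕ.n∸n≡0 t)) (ℕ.*-zeroʳ K)))) (≈-refl {qBinom t t}))) ⟩
      qBinom t (suc t) ⊕ qpow (K * (t ∸ t)) ⊗ qBinom t t
    ∎
    where open ≈-Reasoning

  qBinom-⊗-qFact : ∀ a b → qBinom (a + b) a ⊗ qFact a ≈ qPoch (K + K * b) K a
  qBinom-⊗-qFact a b = ⊗-cancelʳ (Unit-qFact b) (begin
      qBinom (a + b) a ⊗ qFact a ⊗ qFact b
    ≈⟨ ⊗-assoc (qBinom (a + b) a) (qFact a) (qFact b) ⟩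
      qBinom (a + b) a ⊗ (qFact a ⊗ qFact b)
    ≈⟨ ⊗-cong (≈-refl {qBinom (a + b) a}) (⊗-cong (≈-refl {qFact a}) (≈-reflexive (cong qFact (sym (ℕ.m+n∸m≡n a b))))) ⟩
      qBinom (a + b) a ⊗ (qFact a ⊗ qFact (a + b ∸ a))
    ≈⟨ qBinom-product (a + b) a (ℕ.m≤m+n a b) ⟩
      qFact (a + b)
    ≈⟨ ≈-reflexive (cong qFact (ℕ.+-comm a b)) ⟩
      qFact (b + a)
    ≈⟨ qPoch-+ K K b a ⟩
      qFact b ⊗ qPoch (K + K * b) K a
    ≈⟨ ⊗-comm (qFact b) (qPoch (K + K * b) K a) ⟩
      qPoch (K + K * b) K a ⊗ qFact b
    ∎)
    where open ≈-Reasoning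

  qBinom-⊗-inv : ∀ N t → t ≤ N → qBinom N t ⊗ inv (qFact N) ≈ inv (qFact t) ⊗ inv (qFact (N ∸ t))
  qBinom-⊗-inv N t t≤N = ≈-trans
    (quotient-≈ (Unit-qFact N) (≈-sym (begin
      inv (qFact t ⊗ qFact (N ∸ t)) ⊗ qFact N
    ≈⟨ ⊗-cong (≈-refl {inv (qFact t ⊗ qFact (N ∸ t))}) (≈-sym (qBinom-product N t t≤N)) ⟩
      inv (qFact t ⊗ qFact (N ∸ t)) ⊗ (qBinom N t ⊗ (qFact t ⊗ qFact (N ∸ t)))
    ≈⟨ solve 3 (λ i b p → i :* (b :* p) := b :* (i :* p)) ≈-refl (inv (qFact t ⊗ qFact (N ∸ t))) (qBinom N t) (qFact t ⊗ qFact (N ∸ t)) ⟩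
      qBinom N t ⊗ (inv (qFact t ⊗ qFact (N ∸ t)) ⊗ (qFact t ⊗ qFact (N ∸ t)))
    ≈⟨ ⊗-cong (≈-refl {qBinom N t}) (⊗-inverseˡ (Unit-⊗ (Unit-qFact t) (Unit-qFact (N ∸ t)))) ⟩
      qBinom N t ⊗ one
    ≈⟨ ⊗-identityʳ (qBinom N t) ⟩
      qBinom N t
    ∎)))
    (inv-⊗ (Unit-qFact t) (Unit-qFact (N ∸ t)))
    where open ≈-Reasoning

  qFact∞ : FPS
  qFact∞ = qPoch∞ K K

  qBinom-⊗-qFact∞ : ∀ a b L → L ≤ suc a → L ≤ suc b → qBinom (a + b) a ⊗ qFact∞ ≈[ L ] one
  qBinom-⊗-qFact∞ a b L L≤1+a L≤1+b = ≈-≈[]-trans (begin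
      qBinom (a + b) a ⊗ qFact∞
    ≈⟨ ⊗-cong (≈-refl {qBinom (a + b) a}) (qPoch∞-split K K 1≤K 1≤K a) ⟩
      qBinom (a + b) a ⊗ (qFact a ⊗ qPoch∞ (K + K * a) K)
    ≈⟨ ≈-sym (⊗-assoc (qBinom (a + b) a) (qFact a) (qPoch∞ (K + K * a) K)) ⟩
      qBinom (a + b) a ⊗ qFact a ⊗ qPoch∞ (K + K * a) K
    ≈⟨ ⊗-cong (qBinom-⊗-qFact a b) (≈-refl {qPoch∞ (K + K * a) K}) ⟩
      qPoch (K + K * b) K a ⊗ qPoch∞ (K + K * a) K
    ∎)
    (≈[]-≈-trans (≈[]-⊗ (≈[]-mono (L≤K+K* L≤1+b) (qPoch-≈[]-one (K + K * b) K a))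
                        (≈[]-mono (L≤K+K* L≤1+a) (qPoch∞-≈[]-one (K + K * a) K (ℕ.≤-trans 1≤K (ℕ.m≤m+n K (K * a))) 1≤K)))
                 (⊗-identityˡ one))
    where
    open ≈-Reasoning
    L≤K+K* : ∀ {x} → L ≤ suc x → L ≤ K + K * x
    L≤K+K* {x} L≤1+x = ℕ.≤-trans L≤1+x (ℕ.+-mono-≤ 1≤K (ℕ.≤-pred (n<1+K*n x 1≤K)))

-- The Jacobi triple product

choose₂ : ℕ → ℕ
choose₂ zero    = 0
choose₂ (suc t) = t + choose₂ t

choose₂-square : ∀ r → r * r ≡ choose₂ r + choose₂ r + r
choose₂-square zero    = refl
choose₂-square (suc r) = trans (expand r) (trans (cong (λ z → z + (r + r + 1)) (choose₂-square r)) (collect r (choose₂ r)))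
  where
  expand : ∀ r → suc r * suc r ≡ r * r + (r + r + 1)
  expand = ℕ-Solver.solve-∀
  collect : ∀ r c → c + c + r + (r + r + 1) ≡ r + c + (r + c) + suc r
  collect = ℕ-Solver.solve-∀

⊝qpow-⊗-±qpow : ∀ r a b → ⊝ qpow a ⊗ ±qpow r b ≈ ±qpow (suc r) (a + b)
⊝qpow-⊗-±qpow r a b = ≈-trans (≈-sym (⊝-distribˡ-⊗ (qpow a) (±qpow r b))) (⊝-cong (qpow-⊗-±qpow r a b))

±qpow-exchange : ∀ r {a b c d} → a + b ≡ c + d → ±qpow (suc r) a ⊗ qpow b ≈ ⊝ qpow c ⊗ ±qpow r d
±qpow-exchange r {a} {b} {c} {d} a+b≡c+d =
  ≈-trans (±qpow-⊗-qpow (suc r) a b) (≈-trans (±qpow-cong (suc r) a+b≡c+d) (≈-sym (⊝qpow-⊗-±qpow r c d)))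

±qpow-exchange′ : ∀ r {a b c d} → a + b ≡ c + d → ±qpow r a ⊗ qpow b ≈ ⊝ qpow c ⊗ ±qpow (suc r) d
±qpow-exchange′ r {a} {b} {c} {d} a+b≡c+d =
  ≈-trans (±qpow-⊗-qpow r a b) (≈-trans (±qpow-cong r a+b≡c+d)
  (≈-trans (≈-sym (⊝-involutive (±qpow r (c + d)))) (≈-sym (⊝qpow-⊗-±qpow (suc r) c d))))

module Jacobi (I J : ℕ) (1≤I : 1 ≤ I) (1≤J : 1 ≤ J) where

  K : ℕ
  K = I + J

  1≤K : 1 ≤ K
  1≤K = ℕ.≤-trans 1≤I (ℕ.m≤m+n I J)

  open GaussianBinomial K 1≤K public

  -- θ⁺ r and θ⁻ r are the terms of index r and -r of Σ_{r ∈ ℤ} (-1)^r q^{K r(r-1)/2 + I r}.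
  θ⁺ θ⁻ : ℕ → FPS
  θ⁺ r = ±qpow r (K * choose₂ r + I * r)
  θ⁻ r = ±qpow r (K * choose₂ r + J * r)

  ord≥-θ⁺ : ∀ r → ord≥ r (θ⁺ r)
  ord≥-θ⁺ r = ord≥-±qpow r (ℕ.≤-trans (ℕ.≤-pred (n<1+K*n r 1≤I)) (ℕ.m≤n+m (I * r) (K * choose₂ r)))

  ord≥-θ⁻ : ∀ r → ord≥ r (θ⁻ r)
  ord≥-θ⁻ r = ord≥-±qpow r (ℕ.≤-trans (ℕ.≤-pred (n<1+K*n r 1≤J)) (ℕ.m≤n+m (J * r) (K * choose₂ r)))

  θ⁻-suc : ∀ v → θ⁻ (suc v) ≈ ⊝ qpow (J + K * v) ⊗ θ⁻ v
  θ⁻-suc v = ≈-trans (±qpow-cong (suc v) (exponent I J v (choose₂ v))) (≈-sym (⊝qpow-⊗-±qpow v _ _))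
    where
    exponent : ∀ I J v c → (I + J) * (v + c) + J * suc v ≡ J + (I + J) * v + ((I + J) * c + J * v)
    exponent = ℕ-Solver.solve-∀

  -- jacobiTerm v t is the coefficient of [u + v, t] in (q^I; q^K)_u (q^J; q^K)_v:
  -- θ⁺ (t - v) when v ≤ t, and θ⁻ (v - t) otherwise.
  jacobiTerm : ℕ → ℕ → FPS
  jacobiTerm zero    t       = θ⁺ t
  jacobiTerm (suc v) zero    = θ⁻ (suc v)
  jacobiTerm (suc v) (suc t) = jacobiTerm v t

  jacobiTerm-zeroʳ : ∀ v → jacobiTerm v 0 ≈ θ⁻ v
  jacobiTerm-zeroʳ zero    = qpow-cong (cong (λ z → K * 0 + z) (trans (ℕ.*-zeroʳ I) (sym (ℕ.*-zeroʳ J))))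
  jacobiTerm-zeroʳ (suc v) = ≈-refl

  jacobiTerm-shiftᵘ : ∀ v u t → t ≤ v + u →
    jacobiTerm v (suc t) ⊗ qpow (K * (v + u ∸ t)) ≈ ⊝ qpow (I + K * u) ⊗ jacobiTerm v t
  jacobiTerm-shiftᵘ zero u t t≤u = ±qpow-exchange t
    (trans (exponent I J t (choose₂ t) (u ∸ t)) (cong (λ z → I + K * z + (K * choose₂ t + I * t)) (ℕ.m+[n∸m]≡n t≤u)))
    where
    exponent : ∀ I J t c d → (I + J) * (t + c) + I * suc t + (I + J) * d ≡ I + (I + J) * (t + d) + ((I + J) * c + I * t)
    exponent = ℕ-Solver.solve-∀
  jacobiTerm-shiftᵘ (suc v) u zero _ = ≈-trans (⊗-cong (jacobiTerm-zeroʳ v) (≈-refl {qpow (K * suc (v + u))}))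
    (±qpow-exchange′ v (exponent I J v u (choose₂ v)))
    where
    exponent : ∀ I J v u c → (I + J) * c + J * v + (I + J) * suc (v + u) ≡ I + (I + J) * u + ((I + J) * (v + c) + J * suc v)
    exponent = ℕ-Solver.solve-∀
  jacobiTerm-shiftᵘ (suc v) u (suc t) (s≤s t≤v+u) = jacobiTerm-shiftᵘ v u t t≤v+u

  private
    shiftᵛ : ∀ v d s → jacobiTerm v s ⊗ qpow (K * (suc s + d)) ≈ ⊝ qpow (J + K * (v + d)) ⊗ jacobiTerm v (suc s)
    shiftᵛ zero d s = ±qpow-exchange′ s (exponent I J s d (choose₂ s))
      where
      exponent : ∀ I J s d c → (I + J) * c + I * s + (I + J) * (suc s + d) ≡ J + (I + J) * d + ((I + J) * (s + c) + I * suc s)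
      exponent = ℕ-Solver.solve-∀
    shiftᵛ (suc v) d zero = ≈-trans (±qpow-exchange v (exponent I J v d (choose₂ v)))
      (⊗-cong (≈-refl {⊝ qpow (J + K * (suc v + d))}) (≈-sym (jacobiTerm-zeroʳ v)))
      where
      exponent : ∀ I J v d c → (I + J) * (v + c) + J * suc v + (I + J) * suc d ≡ J + (I + J) * (suc v + d) + ((I + J) * c + J * v)
      exponent = ℕ-Solver.solve-∀
    shiftᵛ (suc v) d (suc s) = ≈-trans (⊗-cong (≈-refl {jacobiTerm v s}) (qpow-cong (cong (λ z → K * z) (sym (ℕ.+-suc (suc s) d)))))
      (≈-trans (shiftᵛ v (suc d) s)
               (⊗-cong (⊝-cong (qpow-cong (cong (λ z → J + K * z) (ℕ.+-suc v d)))) (≈-refl {jacobiTerm v (suc s)})))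

  jacobiTerm-shiftᵛ : ∀ v s → jacobiTerm v s ⊗ qpow (K * suc s) ≈ ⊝ qpow (J + K * v) ⊗ jacobiTerm v (suc s)
  jacobiTerm-shiftᵛ v s = ≈-trans (⊗-cong (≈-refl {jacobiTerm v s}) (qpow-cong (cong (λ z → K * z) (sym (ℕ.+-identityʳ (suc s))))))
    (≈-trans (shiftᵛ v 0 s)
             (⊗-cong (⊝-cong (qpow-cong (cong (λ z → J + K * z) (ℕ.+-identityʳ v)))) (≈-refl {jacobiTerm v (suc s)})))

  jacobiSum : ℕ → ℕ → FPS
  jacobiSum u v = fsum (suc (v + u)) (λ t → jacobiTerm v t ⊗ qBinom (v + u) t)

  jacobiSum-sucᵛ : ∀ u v → jacobiSum u (suc v) ≈ (one ⊖ qpow (J + K * v)) ⊗ jacobiSum u v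
  jacobiSum-sucᵛ u v = begin
      fsum (suc (suc N)) (λ t → jacobiTerm (suc v) t ⊗ qBinom (suc N) t)
    ≈⟨ fsum-shift (suc N) (λ t → jacobiTerm (suc v) t ⊗ qBinom (suc N) t) ⟩
      θ⁻ (suc v) ⊗ one ⊕ fsum (suc N) (λ s → jacobiTerm v s ⊗ (qBinom N s ⊕ qpow (K * suc s) ⊗ qBinom N (suc s)))
    ≈⟨ ⊕-cong first (≈-trans (fsum-cong (suc N) (λ s _ → split s)) (fsum-⊕ (suc N) G (λ s → ⊝ y ⊗ G (suc s)))) ⟩
      ⊝ y ⊗ G 0 ⊕ (total ⊕ fsum (suc N) (λ s → ⊝ y ⊗ G (suc s)))
    ≈⟨ ⊕-cong (≈-refl {⊝ y ⊗ G 0}) (⊕-cong (≈-refl {total}) (≈-trans (≈-sym (fsum-⊗ˡ (suc N) (λ s → G (suc s)) (⊝ y)))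
         (⊗-cong (≈-refl {⊝ y}) (fsum-unshift (suc N) G last≈0)))) ⟩
      ⊝ y ⊗ G 0 ⊕ (total ⊕ ⊝ y ⊗ (total ⊕ ⊝ G 0))
    ≈⟨ solve 3 (λ y g t → (:- y) :* g :+ (t :+ (:- y) :* (t :+ (:- g))) := (con (+ 1) :- y) :* t) ≈-refl y (G 0) total ⟩
      (one ⊖ y) ⊗ total
    ∎
    where
    open ≈-Reasoning
    N : ℕ
    N = v + u
    y : FPS
    y = qpow (J + K * v)
    G : ℕ → FPS
    G t = jacobiTerm v t ⊗ qBinom N t
    total : FPS
    total = fsum (suc N) G
    first : θ⁻ (suc v) ⊗ one ≈ ⊝ y ⊗ G 0
    first = ≈-trans (⊗-cong (≈-trans (θ⁻-suc v) (⊗-cong (≈-refl {⊝ y}) (≈-sym (jacobiTerm-zeroʳ v)))) (≈-sym (qBinom-zeroʳ N)))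
                    (⊗-assoc (⊝ y) (jacobiTerm v 0) (qBinom N 0))
    split : ∀ s → jacobiTerm v s ⊗ (qBinom N s ⊕ qpow (K * suc s) ⊗ qBinom N (suc s)) ≈ G s ⊕ ⊝ y ⊗ G (suc s)
    split s = ≈-trans (⊗-distribˡ-⊕ (jacobiTerm v s) (qBinom N s) (qpow (K * suc s) ⊗ qBinom N (suc s)))
      (⊕-cong (≈-refl {G s}) (≈-trans (≈-sym (⊗-assoc (jacobiTerm v s) (qpow (K * suc s)) (qBinom N (suc s))))
        (≈-trans (⊗-cong (jacobiTerm-shiftᵛ v s) (≈-refl {qBinom N (suc s)}))
                 (⊗-assoc (⊝ y) (jacobiTerm v (suc s)) (qBinom N (suc s))))))
    last≈0 : G (suc N) ≈ 0ₛ
    last≈0 = ≈-trans (⊗-cong (≈-refl {jacobiTerm v (suc N)}) (qBinom-> N (suc N) ℕ.≤-refl)) (zeroʳ (jacobiTerm v (suc N)))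

  jacobiSum-sucᵘ : ∀ u v → jacobiSum (suc u) v ≈ (one ⊖ qpow (I + K * u)) ⊗ jacobiSum u v
  jacobiSum-sucᵘ u v = begin
      fsum (suc (v + suc u)) (λ t → jacobiTerm v t ⊗ qBinom (v + suc u) t)
    ≈⟨ ≈-reflexive (cong (λ M → fsum (suc M) (λ t → jacobiTerm v t ⊗ qBinom M t)) (ℕ.+-suc v u)) ⟩
      fsum (suc (suc N)) (λ t → jacobiTerm v t ⊗ qBinom (suc N) t)
    ≈⟨ fsum-shift (suc N) (λ t → jacobiTerm v t ⊗ qBinom (suc N) t) ⟩
      jacobiTerm v 0 ⊗ one ⊕ fsum (suc N) (λ s → jacobiTerm v (suc s) ⊗ qBinom (suc N) (suc s))
    ≈⟨ ⊕-cong (⊗-cong (≈-refl {jacobiTerm v 0}) (≈-sym (qBinom-zeroʳ N)))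
              (≈-trans (fsum-cong (suc N) (λ s s<1+N → split s (ℕ.≤-pred s<1+N))) (fsum-⊕ (suc N) (λ s → G (suc s)) (λ s → ⊝ x ⊗ G s))) ⟩
      G 0 ⊕ (fsum (suc N) (λ s → G (suc s)) ⊕ fsum (suc N) (λ s → ⊝ x ⊗ G s))
    ≈⟨ ⊕-cong (≈-refl {G 0}) (⊕-cong (fsum-unshift (suc N) G last≈0) (≈-sym (fsum-⊗ˡ (suc N) G (⊝ x)))) ⟩
      G 0 ⊕ (total ⊕ ⊝ G 0 ⊕ ⊝ x ⊗ total)
    ≈⟨ solve 3 (λ x g t → g :+ (t :+ (:- g) :+ (:- x) :* t) := (con (+ 1) :- x) :* t) ≈-refl x (G 0) total ⟩
      (one ⊖ x) ⊗ total
    ∎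
    where
    open ≈-Reasoning
    N : ℕ
    N = v + u
    x : FPS
    x = qpow (I + K * u)
    G : ℕ → FPS
    G t = jacobiTerm v t ⊗ qBinom N t
    total : FPS
    total = fsum (suc N) G
    split : ∀ s → s ≤ N → jacobiTerm v (suc s) ⊗ qBinom (suc N) (suc s) ≈ G (suc s) ⊕ ⊝ x ⊗ G s
    split s s≤N = ≈-trans (⊗-cong (≈-refl {jacobiTerm v (suc s)}) (qBinom-pascal′ N s s≤N))
      (≈-trans (⊗-distribˡ-⊕ (jacobiTerm v (suc s)) (qBinom N (suc s)) (qpow (K * (N ∸ s)) ⊗ qBinom N s))
      (⊕-cong (≈-refl {G (suc s)}) (≈-trans (≈-sym (⊗-assoc (jacobiTerm v (suc s)) (qpow (K * (N ∸ s))) (qBinom N s)))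
        (≈-trans (⊗-cong (jacobiTerm-shiftᵘ v u s s≤N) (≈-refl {qBinom N s}))
                 (⊗-assoc (⊝ x) (jacobiTerm v s) (qBinom N s))))))
    last≈0 : G (suc N) ≈ 0ₛ
    last≈0 = ≈-trans (⊗-cong (≈-refl {jacobiTerm v (suc N)}) (qBinom-> N (suc N) ℕ.≤-refl)) (zeroʳ (jacobiTerm v (suc N)))

  finiteJacobi : ∀ u v → qPoch I K u ⊗ qPoch J K v ≈ jacobiSum u v
  finiteJacobi zero    zero    = ≈-trans (⊗-identityˡ one)
    (≈-sym (≈-trans (⊕-identityˡ (θ⁺ 0 ⊗ one)) (≈-trans (⊗-identityʳ (θ⁺ 0)) (qpow-cong (cong₂ _+_ (ℕ.*-zeroʳ K) (ℕ.*-zeroʳ I))))))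
  finiteJacobi zero    (suc v) = ≈-trans
    (solve 3 (λ o p y → o :* (p :* (con (+ 1) :- y)) := (con (+ 1) :- y) :* (o :* p)) ≈-refl one (qPoch J K v) (qpow (J + K * v)))
    (≈-trans (⊗-cong (≈-refl {one ⊖ qpow (J + K * v)}) (finiteJacobi zero v)) (≈-sym (jacobiSum-sucᵛ zero v)))
  finiteJacobi (suc u) v = ≈-trans
    (solve 3 (λ p o y → p :* (con (+ 1) :- y) :* o := (con (+ 1) :- y) :* (p :* o)) ≈-refl (qPoch I K u) (qPoch J K v) (qpow (I + K * u)))
    (≈-trans (⊗-cong (≈-refl {one ⊖ qpow (I + K * u)}) (finiteJacobi u v)) (≈-sym (jacobiSum-sucᵘ u v)))

  fsum-jacobiTerm : ∀ v u (Q : ℕ → FPS) → fsum (suc (v + u)) (λ t → jacobiTerm v t ⊗ Q t)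
    ≈ fsum (suc u) (λ r → θ⁺ r ⊗ Q (v + r)) ⊕ fsum v (λ σ → θ⁻ (suc σ) ⊗ Q (v ∸ suc σ))
  fsum-jacobiTerm zero    u Q = ≈-sym (⊕-identityʳ (fsum (suc u) (λ r → θ⁺ r ⊗ Q r)))
  fsum-jacobiTerm (suc v) u Q = begin
      fsum (suc (suc (v + u))) (λ t → jacobiTerm (suc v) t ⊗ Q t)
    ≈⟨ fsum-shift (suc (v + u)) (λ t → jacobiTerm (suc v) t ⊗ Q t) ⟩
      θ⁻ (suc v) ⊗ Q 0 ⊕ fsum (suc (v + u)) (λ t → jacobiTerm v t ⊗ Q (suc t))
    ≈⟨ ⊕-cong (⊗-cong (≈-refl {θ⁻ (suc v)}) (≈-reflexive (cong Q (sym (ℕ.n∸n≡0 v))))) (fsum-jacobiTerm v u (λ t → Q (suc t))) ⟩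
      θ⁻ (suc v) ⊗ Q (v ∸ v) ⊕ (upper ⊕ fsum v (λ σ → θ⁻ (suc σ) ⊗ Q (suc (v ∸ suc σ))))
    ≈⟨ ⊕-cong (≈-refl {θ⁻ (suc v) ⊗ Q (v ∸ v)}) (⊕-cong (≈-refl {upper})
         (fsum-cong v (λ σ σ<v → ⊗-cong (≈-refl {θ⁻ (suc σ)}) (≈-reflexive (cong Q (sym (ℕ.+-∸-assoc 1 σ<v))))))) ⟩
      θ⁻ (suc v) ⊗ Q (v ∸ v) ⊕ (upper ⊕ fsum v (λ σ → θ⁻ (suc σ) ⊗ Q (v ∸ σ)))
    ≈⟨ solve 3 (λ a b c → a :+ (b :+ c) := b :+ (c :+ a)) ≈-refl
         (θ⁻ (suc v) ⊗ Q (v ∸ v)) upper (fsum v (λ σ → θ⁻ (suc σ) ⊗ Q (v ∸ σ))) ⟩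
      upper ⊕ (fsum v (λ σ → θ⁻ (suc σ) ⊗ Q (v ∸ σ)) ⊕ θ⁻ (suc v) ⊗ Q (v ∸ v))
    ∎
    where
    open ≈-Reasoning
    upper : FPS
    upper = fsum (suc u) (λ r → θ⁺ r ⊗ Q (suc (v + r)))

  summable-θ⁻-suc : Summable (λ σ → θ⁻ (suc σ))
  summable-θ⁻-suc σ = ≈[]-mono (ℕ.n≤1+n σ) (ord≥-θ⁻ (suc σ))

  θ⁺-⊗-qBinom-qFact∞ : ∀ n r → r ≤ n → θ⁺ r ⊗ (qBinom (suc n + n) (suc n + r) ⊗ qFact∞) ≈[ suc n ] θ⁺ r
  θ⁺-⊗-qBinom-qFact∞ n r r≤n = ≈[]-≈-trans (≈[]-mono (ℕ.≤-reflexive (sym r+[1+n∸r]≡1+n))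
    (≈[]-⊗-ord≥ (ord≥-θ⁺ r) (≈-≈[]-trans (⊗-cong (≈-reflexive (cong (λ M → qBinom M (suc n + r)) (sym total))) (≈-refl {qFact∞}))
      (qBinom-⊗-qFact∞ (suc n + r) (n ∸ r) (suc (n ∸ r))
        (s≤s (ℕ.≤-trans (ℕ.m∸n≤m n r) (ℕ.≤-trans (ℕ.n≤1+n n) (ℕ.m≤m+n (suc n) r)))) ℕ.≤-refl))))
    (⊗-identityʳ (θ⁺ r))
    where
    total : suc n + r + (n ∸ r) ≡ suc n + n
    total = trans (ℕ.+-assoc (suc n) r (n ∸ r)) (cong (λ z → suc n + z) (ℕ.m+[n∸m]≡n r≤n))
    r+[1+n∸r]≡1+n : r + suc (n ∸ r) ≡ suc n
    r+[1+n∸r]≡1+n = trans (ℕ.+-suc r (n ∸ r)) (cong suc (ℕ.m+[n∸m]≡n r≤n))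

  θ⁻-⊗-qBinom-qFact∞ : ∀ n σ → σ ≤ n → θ⁻ (suc σ) ⊗ (qBinom (suc n + n) (n ∸ σ) ⊗ qFact∞) ≈[ suc n ] θ⁻ (suc σ)
  θ⁻-⊗-qBinom-qFact∞ n σ σ≤n = ≈[]-≈-trans (≈[]-mono (ℕ.≤-trans (ℕ.n≤1+n (suc n)) (ℕ.≤-reflexive (sym σ+[1+n∸σ]≡1+n)))
    (≈[]-⊗-ord≥ (ord≥-θ⁻ (suc σ)) (≈-≈[]-trans (⊗-cong (≈-reflexive (cong (λ M → qBinom M (n ∸ σ)) (sym total))) (≈-refl {qFact∞}))
      (qBinom-⊗-qFact∞ (n ∸ σ) (suc n + σ) (suc (n ∸ σ)) ℕ.≤-refl
        (s≤s (ℕ.≤-trans (ℕ.m∸n≤m n σ) (ℕ.≤-trans (ℕ.n≤1+n n) (ℕ.m≤m+n (suc n) σ))))))))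
    (⊗-identityʳ (θ⁻ (suc σ)))
    where
    total : n ∸ σ + (suc n + σ) ≡ suc n + n
    total = trans (ℕ.+-comm (n ∸ σ) (suc n + σ)) (trans (ℕ.+-assoc (suc n) σ (n ∸ σ)) (cong (λ z → suc n + z) (ℕ.m+[n∸m]≡n σ≤n)))
    σ+[1+n∸σ]≡1+n : suc σ + suc (n ∸ σ) ≡ suc (suc n)
    σ+[1+n∸σ]≡1+n = cong suc (trans (ℕ.+-suc σ (n ∸ σ)) (cong suc (ℕ.m+[n∸m]≡n σ≤n)))

  -- Below degree n + 1 the infinite products agree with the finite ones of lengths n and n + 1,
  -- and [a + b, a] (q^K; q^K)_∞ = (q^{K(b+1)}; q^K)_a (q^{K(a+1)}; q^K)_∞ is 1 below degree
  -- min(a, b) + 1, which the order of the θ factor makes up to n + 1.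
  jacobiTripleProduct : qPoch∞ I K ⊗ qPoch∞ J K ⊗ qFact∞ ≈ sumInf θ⁺ ⊕ sumInf (λ σ → θ⁻ (suc σ))
  jacobiTripleProduct = ≈[]⇒≈ λ n → let N = suc n + n in
    ≈[]-trans (≈[]-⊗ (≈[]-⊗ (qPoch∞-≈[]-qPoch I K 1≤I 1≤K n) (≈[]-mono (ℕ.n≤1+n (suc n)) (qPoch∞-≈[]-qPoch J K 1≤J 1≤K (suc n))))
                     (≈[]-refl {qFact∞}))
    (≈-≈[]-trans (begin
        qPoch I K n ⊗ qPoch J K (suc n) ⊗ qFact∞
      ≈⟨ ⊗-cong (finiteJacobi n (suc n)) (≈-refl {qFact∞}) ⟩
        fsum (suc N) (λ t → jacobiTerm (suc n) t ⊗ qBinom N t) ⊗ qFact∞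
      ≈⟨ fsum-⊗ʳ (suc N) (λ t → jacobiTerm (suc n) t ⊗ qBinom N t) qFact∞ ⟩
        fsum (suc N) (λ t → jacobiTerm (suc n) t ⊗ qBinom N t ⊗ qFact∞)
      ≈⟨ fsum-cong (suc N) (λ t _ → ⊗-assoc (jacobiTerm (suc n) t) (qBinom N t) qFact∞) ⟩
        fsum (suc N) (λ t → jacobiTerm (suc n) t ⊗ (qBinom N t ⊗ qFact∞))
      ≈⟨ fsum-jacobiTerm (suc n) n (λ t → qBinom N t ⊗ qFact∞) ⟩
        fsum (suc n) (λ r → θ⁺ r ⊗ (qBinom N (suc n + r) ⊗ qFact∞))
          ⊕ fsum (suc n) (λ σ → θ⁻ (suc σ) ⊗ (qBinom N (n ∸ σ) ⊗ qFact∞))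
      ∎)
    (≈[]-trans (≈[]-⊕ (≈[]-fsum (suc n) (λ r r<1+n → θ⁺-⊗-qBinom-qFact∞ n r (ℕ.≤-pred r<1+n)))
                      (≈[]-fsum (suc n) (λ σ σ<1+n → θ⁻-⊗-qBinom-qFact∞ n σ (ℕ.≤-pred σ<1+n))))
               (≈[]-⊕ (≈[]-sym (sumInf-≈[]-fsum ord≥-θ⁺ n)) (≈[]-sym (sumInf-≈[]-fsum summable-θ⁻-suc n)))))
    where open ≈-Reasoning

-- The Durfee rectangle identity

module Durfee (K : ℕ) (1≤K : 1 ≤ K) where

  open GaussianBinomial K 1≤K

  -- finiteDurfee is a finite form of
  -- Σ_s q^{K s (s+m)} / ((q^K; q^K)_s (q^K; q^K)_{s+m}) = 1 / (q^K; q^K)_∞.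
  durfeeTerm : ℕ → ℕ → ℕ → FPS
  durfeeTerm N m s = qpow (K * (s * (s + m))) ⊗ (qBinom N s ⊗ qPoch (K * suc (s + m)) K (N ∸ s))

  private
    -- By the first Pascal rule durfeeTerm (N + 1) m (s + 1) = X s + V (s + 1), while
    -- V σ = durfeeTerm N (m + 1) σ - X σ, so the sum over s telescopes.
    module Step (N m : ℕ) where
      X V : ℕ → FPS
      X s = qpow (K * (suc s * (suc s + m))) ⊗ (qBinom N s ⊗ qPoch (K * suc (suc (s + m))) K (N ∸ s))
      V σ = qpow (K * (σ * (σ + suc m))) ⊗ (qBinom N σ ⊗ qPoch (K * suc (σ + m)) K (suc N ∸ σ))

      split : ∀ s → durfeeTerm (suc N) m (suc s) ≈ X s ⊕ V (suc s)
      split s = begin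
          qpow a ⊗ ((qBinom N s ⊕ qpow (K * suc s) ⊗ qBinom N (suc s)) ⊗ R)
        ≈⟨ solve 5 (λ x y z w u → x :* ((y :+ z :* w) :* u) := x :* (y :* u) :+ (x :* z) :* (w :* u))
                 ≈-refl (qpow a) (qBinom N s) (qpow (K * suc s)) (qBinom N (suc s)) R ⟩
          X s ⊕ qpow a ⊗ qpow (K * suc s) ⊗ (qBinom N (suc s) ⊗ R)
        ≈⟨ ⊕-cong (≈-refl {X s}) (⊗-cong (≈-trans (qpow-+ a (K * suc s)) (qpow-cong (exponent K s m))) (≈-refl {qBinom N (suc s) ⊗ R})) ⟩
          X s ⊕ V (suc s)
        ∎
        where
        open ≈-Reasoning
        a : ℕ
        a = K * (suc s * (suc s + m))
        R : FPS
        R = qPoch (K * suc (suc (s + m))) K (N ∸ s)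
        exponent : ∀ K s m → K * (suc s * (suc s + m)) + K * suc s ≡ K * (suc s * (suc s + suc m))
        exponent = ℕ-Solver.solve-∀

      V≈durfeeTerm-X : ∀ σ → σ ≤ N → V σ ≈ durfeeTerm N (suc m) σ ⊕ ⊝ X σ
      V≈durfeeTerm-X σ σ≤N = begin
          qpow e ⊗ (qBinom N σ ⊗ qPoch (K * suc (σ + m)) K (suc N ∸ σ))
        ≈⟨ ⊗-cong (≈-refl {qpow e}) (⊗-cong (≈-refl {qBinom N σ})
             (≈-trans (≈-reflexive (cong (qPoch (K * suc (σ + m)) K) (ℕ.+-∸-assoc 1 σ≤N)))
             (≈-trans (qPoch-sucˡ (K * suc (σ + m)) K (N ∸ σ))
                      (⊗-cong (≈-refl {one ⊖ y}) (≈-reflexive (cong (λ z → qPoch z K (N ∸ σ)) (exponentR K σ m))))))) ⟩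
          qpow e ⊗ (qBinom N σ ⊗ ((one ⊖ y) ⊗ R))
        ≈⟨ solve 4 (λ a b y r → a :* (b :* ((con (+ 1) :- y) :* r)) := a :* (b :* r) :+ (:- ((a :* y) :* (b :* r))))
                 ≈-refl (qpow e) (qBinom N σ) y R ⟩
          qpow e ⊗ (qBinom N σ ⊗ R) ⊕ ⊝ (qpow e ⊗ y ⊗ (qBinom N σ ⊗ R))
        ≈⟨ ⊕-cong (⊗-cong (≈-refl {qpow e}) (⊗-cong (≈-refl {qBinom N σ}) (≈-reflexive (cong (λ z → qPoch z K (N ∸ σ)) (exponentT K σ m)))))
                  (⊝-cong (⊗-cong (≈-trans (qpow-+ e (K * suc (σ + m))) (qpow-cong (exponentX K σ m))) (≈-refl {qBinom N σ ⊗ R}))) ⟩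
          durfeeTerm N (suc m) σ ⊕ ⊝ X σ
        ∎
        where
        open ≈-Reasoning
        e : ℕ
        e = K * (σ * (σ + suc m))
        y R : FPS
        y = qpow (K * suc (σ + m))
        R = qPoch (K * suc (suc (σ + m))) K (N ∸ σ)
        exponentR : ∀ K σ m → K * suc (σ + m) + K ≡ K * suc (suc (σ + m))
        exponentR = ℕ-Solver.solve-∀
        exponentT : ∀ K σ m → K * suc (suc (σ + m)) ≡ K * suc (σ + suc m)
        exponentT = ℕ-Solver.solve-∀
        exponentX : ∀ K σ m → K * (σ * (σ + suc m)) + K * suc (σ + m) ≡ K * (suc σ * (suc σ + m))
        exponentX = ℕ-Solver.solve-∀

      V-last : V (suc N) ≈ 0ₛ
      V-last = ≈-trans (⊗-cong (≈-refl {qpow (K * (suc N * (suc N + suc m)))})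
                       (≈-trans (⊗-cong (qBinom-> N (suc N) ℕ.≤-refl) (≈-refl {qPoch (K * suc (suc N + m)) K (N ∸ N)}))
                                (zeroˡ (qPoch (K * suc (suc N + m)) K (N ∸ N)))))
                       (zeroʳ (qpow (K * (suc N * (suc N + suc m)))))

      finiteDurfee-step : fsum (suc (suc N)) (durfeeTerm (suc N) m) ≈ fsum (suc N) (durfeeTerm N (suc m))
      finiteDurfee-step = begin
          fsum (suc (suc N)) (durfeeTerm (suc N) m)
        ≈⟨ fsum-shift (suc N) (durfeeTerm (suc N) m) ⟩
          durfeeTerm (suc N) m 0 ⊕ fsum (suc N) (λ s → durfeeTerm (suc N) m (suc s))
        ≈⟨ ⊕-cong (⊗-cong (≈-refl {qpow (K * 0)}) (⊗-cong (≈-sym (qBinom-zeroʳ N)) (≈-refl {qPoch (K * suc m) K (suc N)})))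
                  (≈-trans (fsum-cong (suc N) (λ s _ → split s)) (fsum-⊕ (suc N) X (λ s → V (suc s)))) ⟩
          V 0 ⊕ (fsum (suc N) X ⊕ fsum (suc N) (λ s → V (suc s)))
        ≈⟨ ⊕-cong (≈-refl {V 0}) (⊕-cong (≈-refl {fsum (suc N) X}) (fsum-unshift (suc N) V V-last)) ⟩
          V 0 ⊕ (fsum (suc N) X ⊕ (fsum (suc N) V ⊕ ⊝ V 0))
        ≈⟨ ⊕-cong (≈-refl {V 0}) (⊕-cong (≈-refl {fsum (suc N) X}) (⊕-cong
             (≈-trans (fsum-cong (suc N) (λ σ σ<1+N → V≈durfeeTerm-X σ (ℕ.≤-pred σ<1+N)))
             (≈-trans (fsum-⊕ (suc N) (durfeeTerm N (suc m)) (λ σ → ⊝ X σ))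
                      (⊕-cong (≈-refl {fsum (suc N) (durfeeTerm N (suc m))}) (fsum-⊝ (suc N) X))))
             (≈-refl {⊝ V 0}))) ⟩
          V 0 ⊕ (fsum (suc N) X ⊕ (fsum (suc N) (durfeeTerm N (suc m)) ⊕ ⊝ fsum (suc N) X ⊕ ⊝ V 0))
        ≈⟨ solve 3 (λ v x d → v :+ (x :+ (d :+ (:- x) :+ (:- v))) := d) ≈-refl (V 0) (fsum (suc N) X) (fsum (suc N) (durfeeTerm N (suc m))) ⟩
          fsum (suc N) (durfeeTerm N (suc m))
        ∎
        where open ≈-Reasoning

  finiteDurfee : ∀ N m → fsum (suc N) (durfeeTerm N m) ≈ one
  finiteDurfee zero    m = ≈-trans (⊕-identityˡ (durfeeTerm 0 m 0))
    (≈-trans (⊗-cong (qpow-cong (ℕ.*-zeroʳ K)) (⊗-identityˡ one)) (⊗-identityʳ one))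
  finiteDurfee (suc N) m = ≈-trans (Step.finiteDurfee-step N m) (finiteDurfee N (suc m))

  durfeeSummand : ℕ → ℕ → FPS
  durfeeSummand m s = qpow (K * (s * (s + m))) ⊗ inv (qFact s) ⊗ inv (qFact (s + m))

  ord≥-durfeeExponent : ∀ m s → ord≥ s (qpow (K * (s * (s + m))))
  ord≥-durfeeExponent m s = ord≥-qpow (ℕ.≤-trans (s≤s*[s+m] s m) (ℕ.≤-pred (n<1+K*n (s * (s + m)) 1≤K)))
    where
    s≤s*[s+m] : ∀ s m → s ≤ s * (s + m)
    s≤s*[s+m] zero    m = z≤n
    s≤s*[s+m] (suc s) m = ℕ.m≤m*n (suc s) (suc (s + m))

  summable-durfeeSummand : ∀ m → Summable (durfeeSummand m)
  summable-durfeeSummand m s = ord≥-⊗ʳ (inv (qFact (s + m))) (ord≥-⊗ʳ (inv (qFact s)) (ord≥-durfeeExponent m s))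

  qBinom-≈-inv : ∀ L s → s ≤ L → qBinom L s ≈ inv (qFact s) ⊗ qPoch (K + K * (L ∸ s)) K s
  qBinom-≈-inv L s s≤L = ≈-trans (≈-sym (quotient-≈ (Unit-qFact s) (≈-sym (≈-trans
      (⊗-cong (≈-reflexive (cong (λ M → qBinom M s) (sym (ℕ.m+[n∸m]≡n s≤L)))) (≈-refl {qFact s}))
      (qBinom-⊗-qFact s (L ∸ s))))))
    (⊗-comm (qPoch (K + K * (L ∸ s)) K s) (inv (qFact s)))

  durfeeSummand-≈[] : ∀ m L s → s ≤ L → durfeeSummand m s ⊗ qFact∞ ≈[ suc L ] durfeeTerm L m s
  durfeeSummand-≈[] m L s s≤L = ≈-≈[]-trans left
    (≈[]-≈-trans (≈[]-mono (ℕ.≤-reflexive (sym s+[1+d]≡1+L))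
                           (≈[]-⊗-ord≥ (ord≥-durfeeExponent m s) (≈[]-⊗ (≈[]-refl {inv (qFact s)}) tail≈[]))) (≈-sym right))
    where
    open ≈-Reasoning
    d e : ℕ
    d = L ∸ s
    e = K * (s * (s + m))
    tail∞ tail : FPS
    tail∞ = qPoch∞ (K + K * (s + m)) K
    tail = qPoch (K + K * d) K s ⊗ qPoch (K * suc (s + m)) K d
    s+[1+d]≡1+L : s + suc d ≡ suc L
    s+[1+d]≡1+L = trans (ℕ.+-suc s d) (cong suc (ℕ.m+[n∸m]≡n s≤L))
    left : durfeeSummand m s ⊗ qFact∞ ≈ qpow e ⊗ (inv (qFact s) ⊗ tail∞)
    left = begin
        qpow e ⊗ inv (qFact s) ⊗ inv (qFact (s + m)) ⊗ qFact∞
      ≈⟨ ⊗-cong (≈-refl {qpow e ⊗ inv (qFact s) ⊗ inv (qFact (s + m))}) (qPoch∞-split K K 1≤K 1≤K (s + m)) ⟩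
        qpow e ⊗ inv (qFact s) ⊗ inv (qFact (s + m)) ⊗ (qFact (s + m) ⊗ tail∞)
      ≈⟨ solve 5 (λ a b c d r → a :* b :* c :* (d :* r) := a :* (b :* r) :* (c :* d))
               ≈-refl (qpow e) (inv (qFact s)) (inv (qFact (s + m))) (qFact (s + m)) tail∞ ⟩
        qpow e ⊗ (inv (qFact s) ⊗ tail∞) ⊗ (inv (qFact (s + m)) ⊗ qFact (s + m))
      ≈⟨ ≈-trans (⊗-cong (≈-refl {qpow e ⊗ (inv (qFact s) ⊗ tail∞)}) (⊗-inverseˡ (Unit-qFact (s + m))))
                 (⊗-identityʳ (qpow e ⊗ (inv (qFact s) ⊗ tail∞))) ⟩
        qpow e ⊗ (inv (qFact s) ⊗ tail∞)
      ∎
    right : durfeeTerm L m s ≈ qpow e ⊗ (inv (qFact s) ⊗ tail)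
    right = ⊗-cong (≈-refl {qpow e}) (≈-trans (⊗-cong (qBinom-≈-inv L s s≤L) (≈-refl {qPoch (K * suc (s + m)) K d}))
      (⊗-assoc (inv (qFact s)) (qPoch (K + K * d) K s) (qPoch (K * suc (s + m)) K d)))
    tail≈[] : tail∞ ≈[ suc d ] tail
    tail≈[] = ≈[]-trans (qPoch∞-≈[]-qPoch (K + K * (s + m)) K (ℕ.≤-trans 1≤K (ℕ.m≤m+n K (K * (s + m)))) 1≤K d)
      (≈[]-trans (≈⇒≈[] (suc d) (≈-trans (≈-sym (⊗-identityˡ (qPoch (K + K * (s + m)) K d)))
                   (⊗-cong (≈-refl {one}) (≈-reflexive (cong (λ z → qPoch z K d) (sym (ℕ.*-suc K (s + m))))))))
                 (≈[]-⊗ (≈[]-sym (≈[]-mono (ℕ.+-mono-≤ 1≤K (ℕ.≤-pred (n<1+K*n d 1≤K))) (qPoch-≈[]-one (K + K * d) K s)))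
                        (≈[]-refl {qPoch (K * suc (s + m)) K d})))

  durfee : ∀ m → sumInf (durfeeSummand m) ≈ inv qFact∞
  durfee m = ≈-sym (≈-trans (≈-sym (⊗-identityˡ (inv qFact∞)))
    (quotient-≈ (Unit-qPoch∞ K K 1≤K) (≈-sym (≈[]⇒≈ λ L →
      ≈-≈[]-trans (sumInf-⊗ʳ (summable-durfeeSummand m) qFact∞)
      (≈[]-trans (sumInf-≈[]-fsum (λ s → ord≥-⊗ʳ qFact∞ (summable-durfeeSummand m s)) L)
      (≈[]-≈-trans (≈[]-fsum (suc L) (λ s s<1+L → durfeeSummand-≈[] m L s (ℕ.≤-pred s<1+L))) (finiteDurfee L m)))))))

  durfee-shifted : ∀ {Z} c m E → Summable Z → (∀ n → n < c → Z n ≈ 0ₛ) →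
    (∀ s → Z (c + s) ≈ qpow (K * E) ⊗ durfeeSummand m s) → sumInf Z ≈ qpow (K * E) ⊗ inv qFact∞
  durfee-shifted {Z} c m E summable vanish shifted = begin
    sumInf Z                                        ≈⟨ sumInf-shift c summable vanish ⟩
    sumInf (λ s → Z (c + s))                        ≈⟨ sumInf-cong shifted ⟩
    sumInf (λ s → qpow (K * E) ⊗ durfeeSummand m s) ≈⟨ ≈-sym (sumInf-⊗ˡ (summable-durfeeSummand m) (qpow (K * E))) ⟩
    qpow (K * E) ⊗ sumInf (durfeeSummand m)         ≈⟨ ⊗-cong (≈-refl {qpow (K * E)}) (durfee m) ⟩
    qpow (K * E) ⊗ inv qFact∞                       ∎
    where open ≈-Reasoning

-- The bilateral sums

-- The two sums of the theorem are the cases e = 0 and e = 1, with k = i + j.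
module Bilateral (i j : ℕ) (1≤i : 1 ≤ i) (1≤j : 1 ≤ j) (e : ℕ) where

  open Jacobi i j 1≤i 1≤j public
  open Durfee K 1≤K public using (durfeeSummand; durfee-shifted; ord≥-durfeeExponent)

  summand : ℕ → FPS
  summand n = qpow (K * (n * (n + e))) ⊗ qPoch i K (n + e) ⊗ qPoch j K n ⊗ inv (qFact (n + (n + e)))

  piece : ℕ → ℕ → FPS
  piece n t = qpow (K * (n * (n + e))) ⊗ (inv (qFact t) ⊗ inv (qFact (n + (n + e) ∸ t)))

  ord≥-piece : ∀ n t → ord≥ n (piece n t)
  ord≥-piece n t = ord≥-⊗ʳ (inv (qFact t) ⊗ inv (qFact (n + (n + e) ∸ t))) (ord≥-durfeeExponent e n)

  piece-durfee : ∀ n t E m s → n * (n + e) ≡ E + s * (s + m) →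
    inv (qFact t) ⊗ inv (qFact (n + (n + e) ∸ t)) ≈ inv (qFact s) ⊗ inv (qFact (s + m)) →
    piece n t ≈ qpow (K * E) ⊗ durfeeSummand m s
  piece-durfee n t E m s exponent factorials = begin
      qpow (K * (n * (n + e))) ⊗ (inv (qFact t) ⊗ inv (qFact (n + (n + e) ∸ t)))
    ≈⟨ ⊗-cong (≈-trans (qpow-cong (trans (cong (λ z → K * z) exponent) (ℕ.*-distribˡ-+ K E (s * (s + m)))))
                       (≈-sym (qpow-+ (K * E) (K * (s * (s + m)))))) factorials ⟩
      qpow (K * E) ⊗ qpow (K * (s * (s + m))) ⊗ (inv (qFact s) ⊗ inv (qFact (s + m)))
    ≈⟨ solve 4 (λ a b c d → a :* b :* (c :* d) := a :* (b :* c :* d)) ≈-refl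
         (qpow (K * E)) (qpow (K * (s * (s + m)))) (inv (qFact s)) (inv (qFact (s + m))) ⟩
      qpow (K * E) ⊗ durfeeSummand m s
    ∎
    where open ≈-Reasoning

  -- The coefficients of θ⁺ r and of θ⁻ (σ + 1) in the expansion of summand n,
  -- extended by zero beyond the range of the finite sum.
  upperPiece lowerPiece : ℕ → ℕ → FPS
  upperPiece n = (λ r → piece n (n + r)) ↾ suc (n + e)
  lowerPiece n = (λ σ → piece n (n ∸ suc σ)) ↾ n

  ord≥-upperPiece : ∀ n r → ord≥ n (upperPiece n r)
  ord≥-upperPiece n r = ord≥-↾ (λ r → piece n (n + r)) (suc (n + e)) r (ord≥-piece n (n + r))

  upperPiece-< : ∀ n r → r < suc (n + e) → upperPiece n r ≈ piece n (n + r)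
  upperPiece-< n r = ↾-< (λ r → piece n (n + r))

  upperPiece-≥ : ∀ n r → suc (n + e) ≤ r → upperPiece n r ≈ 0ₛ
  upperPiece-≥ n r = ↾-≥ (λ r → piece n (n + r))

  ord≥-lowerPiece : ∀ n σ → ord≥ n (lowerPiece n σ)
  ord≥-lowerPiece n σ = ord≥-↾ (λ σ → piece n (n ∸ suc σ)) n σ (ord≥-piece n (n ∸ suc σ))

  lowerPiece-< : ∀ n σ → σ < n → lowerPiece n σ ≈ piece n (n ∸ suc σ)
  lowerPiece-< n σ = ↾-< (λ σ → piece n (n ∸ suc σ))

  lowerPiece-≥ : ∀ n σ → n ≤ σ → lowerPiece n σ ≈ 0ₛ
  lowerPiece-≥ n σ = ↾-≥ (λ σ → piece n (n ∸ suc σ))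

  summand-expand : ∀ n → summand n ≈ fsum (suc (n + (n + e))) (λ t → jacobiTerm n t ⊗ piece n t)
  summand-expand n = begin
      qn ⊗ qPoch i K (n + e) ⊗ qPoch j K n ⊗ inv (qFact N)
    ≈⟨ ⊗-cong (≈-trans (⊗-assoc qn (qPoch i K (n + e)) (qPoch j K n)) (⊗-cong (≈-refl {qn}) (finiteJacobi (n + e) n)))
              (≈-refl {inv (qFact N)}) ⟩
      qn ⊗ fsum (suc N) (λ t → jacobiTerm n t ⊗ qBinom N t) ⊗ inv (qFact N)
    ≈⟨ ≈-trans (⊗-cong (fsum-⊗ˡ (suc N) (λ t → jacobiTerm n t ⊗ qBinom N t) qn) (≈-refl {inv (qFact N)}))
               (fsum-⊗ʳ (suc N) (λ t → qn ⊗ (jacobiTerm n t ⊗ qBinom N t)) (inv (qFact N))) ⟩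
      fsum (suc N) (λ t → qn ⊗ (jacobiTerm n t ⊗ qBinom N t) ⊗ inv (qFact N))
    ≈⟨ fsum-cong (suc N) (λ t t<1+N → ≈-trans
         (solve 4 (λ a b c d → a :* (b :* c) :* d := b :* (a :* (c :* d))) ≈-refl qn (jacobiTerm n t) (qBinom N t) (inv (qFact N)))
         (⊗-cong (≈-refl {jacobiTerm n t}) (⊗-cong (≈-refl {qn}) (qBinom-⊗-inv N t (ℕ.≤-pred t<1+N))))) ⟩
      fsum (suc N) (λ t → jacobiTerm n t ⊗ piece n t)
    ∎
    where
    open ≈-Reasoning
    N : ℕ
    N = n + (n + e)
    qn : FPS
    qn = qpow (K * (n * (n + e)))

  summand-rearranged : sumInf summand ≈
    sumInf (λ r → θ⁺ r ⊗ sumInf (λ n → upperPiece n r)) ⊕ sumInf (λ σ → θ⁻ (suc σ) ⊗ sumInf (λ n → lowerPiece n σ))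
  summand-rearranged = begin
      sumInf summand
    ≈⟨ sumInf-cong (λ n → ≈-trans (summand-expand n) (fsum-jacobiTerm n (n + e) (piece n))) ⟩
      sumInf (λ n → fsum (suc (n + e)) (λ r → θ⁺ r ⊗ piece n (n + r)) ⊕ fsum n (λ σ → θ⁻ (suc σ) ⊗ piece n (n ∸ suc σ)))
    ≈⟨ ≈-trans (sumInf-cong (λ n → ⊕-cong (upper n) (lower n))) (sumInf-⊕ _ _) ⟩
      sumInf (λ n → sumInf (λ r → θ⁺ r ⊗ upperPiece n r)) ⊕ sumInf (λ n → sumInf (λ σ → θ⁻ (suc σ) ⊗ lowerPiece n σ))
    ≈⟨ ⊕-cong (≈-trans (sumInf-swap (λ n r → θ⁺ r ⊗ upperPiece n r))
                       (sumInf-cong (λ r → ≈-sym (sumInf-⊗ˡ (λ n → ord≥-upperPiece n r) (θ⁺ r)))))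
              (≈-trans (sumInf-swap (λ n σ → θ⁻ (suc σ) ⊗ lowerPiece n σ))
                       (sumInf-cong (λ σ → ≈-sym (sumInf-⊗ˡ (λ n → ord≥-lowerPiece n σ) (θ⁻ (suc σ)))))) ⟩
      sumInf (λ r → θ⁺ r ⊗ sumInf (λ n → upperPiece n r)) ⊕ sumInf (λ σ → θ⁻ (suc σ) ⊗ sumInf (λ n → lowerPiece n σ))
    ∎
    where
    open ≈-Reasoning
    upper : ∀ n → fsum (suc (n + e)) (λ r → θ⁺ r ⊗ piece n (n + r)) ≈ sumInf (λ r → θ⁺ r ⊗ upperPiece n r)
    upper n = ≈-trans (fsum-≈-sumInf-↾ (suc (n + e)) (λ r → ord≥-⊗ʳ (piece n (n + r)) (ord≥-θ⁺ r)))
                      (sumInf-cong (↾-⊗ˡ θ⁺ (λ r → piece n (n + r)) (suc (n + e))))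
    lower : ∀ n → fsum n (λ σ → θ⁻ (suc σ) ⊗ piece n (n ∸ suc σ)) ≈ sumInf (λ σ → θ⁻ (suc σ) ⊗ lowerPiece n σ)
    lower n = ≈-trans (fsum-≈-sumInf-↾ n (λ σ → ord≥-⊗ʳ (piece n (n ∸ suc σ)) (summable-θ⁻-suc σ)))
                      (sumInf-cong (↾-⊗ˡ (λ σ → θ⁻ (suc σ)) (λ σ → piece n (n ∸ suc σ)) n))

  lowerPiece-sum : ∀ σ → sumInf (λ n → lowerPiece n σ) ≈ qpow (K * (suc σ * (suc σ + e))) ⊗ inv qFact∞
  lowerPiece-sum σ = durfee-shifted (suc σ) m (suc σ * (suc σ + e)) (λ n → ord≥-lowerPiece n σ)
    (λ n n≤σ → lowerPiece-≥ n σ (ℕ.≤-pred n≤σ))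
    (λ s → ≈-trans (lowerPiece-< (suc σ + s) σ (s≤s (ℕ.m≤m+n σ s)))
      (piece-durfee (suc σ + s) (suc σ + s ∸ suc σ) (suc σ * (suc σ + e)) m s (exponent σ s e)
        (≈-reflexive (cong₂ (λ a b → inv (qFact a) ⊗ inv (qFact b)) (ℕ.m+n∸m≡n (suc σ) s)
          (trans (cong (λ z → (suc σ + s) + ((suc σ + s) + e) ∸ z) (ℕ.m+n∸m≡n (suc σ) s))
                 (trans (cong (_∸ s) (size σ s e)) (ℕ.m+n∸m≡n s (s + m))))))))
    where
    m : ℕ
    m = suc σ + suc σ + e
    exponent : ∀ σ s e → (suc σ + s) * ((suc σ + s) + e) ≡ suc σ * (suc σ + e) + s * (s + (suc σ + suc σ + e))
    exponent = ℕ-Solver.solve-∀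
    size : ∀ σ s e → (suc σ + s) + ((suc σ + s) + e) ≡ s + (s + (suc σ + suc σ + e))
    size = ℕ-Solver.solve-∀

  J′ : ℕ
  J′ = K + K * e + j

  1≤J′ : 1 ≤ J′
  1≤J′ = ℕ.≤-trans 1≤j (ℕ.m≤n+m j (K + K * e))

  -- After the inner sums are evaluated, what is left is a theta series in base q^{3k}.
  module InBase3K (I′ : ℕ) (1≤I′ : 1 ≤ I′) (I′+J′≡3K : I′ + J′ ≡ 3 * K) where

    module Θ = Jacobi I′ J′ 1≤I′ 1≤J′

    θ⁻-lift : ∀ σ → θ⁻ (suc σ) ⊗ qpow (K * (suc σ * (suc σ + e))) ≈ Θ.θ⁻ (suc σ)
    θ⁻-lift σ = ≈-trans (±qpow-⊗-qpow (suc σ) (K * c + j * t) (K * (t * (t + e)))) (±qpow-cong (suc σ) exponent)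
      where
      open ≡-Reasoning
      t c : ℕ
      t = suc σ
      c = choose₂ t
      expand : ∀ K j t c e → K * c + j * t + K * (t * (t + e)) ≡ K * c + j * t + K * (t * t) + K * (t * e)
      expand = ℕ-Solver.solve-∀
      collect : ∀ K j t c e → K * c + j * t + K * (c + c + t) + K * (t * e) ≡ 3 * K * c + (K + K * e + j) * t
      collect = ℕ-Solver.solve-∀
      exponent : K * c + j * t + K * (t * (t + e)) ≡ (I′ + J′) * c + J′ * t
      exponent = begin
        K * c + j * t + K * (t * (t + e))              ≡⟨ expand K j t c e ⟩
        K * c + j * t + K * (t * t) + K * (t * e)      ≡⟨ cong (λ z → K * c + j * t + K * z + K * (t * e)) (choose₂-square t) ⟩
        K * c + j * t + K * (c + c + t) + K * (t * e)  ≡⟨ collect K j t c e ⟩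
        3 * K * c + J′ * t                             ≡⟨ cong (λ z → z * c + J′ * t) (sym I′+J′≡3K) ⟩
        (I′ + J′) * c + J′ * t                         ∎

    bilateral : (E : ℕ → ℕ) →
      (∀ r → sumInf (λ n → upperPiece n r) ≈ qpow (K * E r) ⊗ inv qFact∞) →
      (∀ r → θ⁺ r ⊗ qpow (K * E r) ≈ Θ.θ⁺ r) →
      sumInf summand ≈ qPoch∞ I′ Θ.K ⊗ qPoch∞ J′ Θ.K ⊗ Θ.qFact∞ ⊗ inv qFact∞
    bilateral E upperPiece-sum θ⁺-lift = begin
        sumInf summand
      ≈⟨ summand-rearranged ⟩
        sumInf (λ r → θ⁺ r ⊗ sumInf (λ n → upperPiece n r)) ⊕ sumInf (λ σ → θ⁻ (suc σ) ⊗ sumInf (λ n → lowerPiece n σ))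
      ≈⟨ ⊕-cong (sumInf-cong (λ r → ≈-trans (⊗-cong (≈-refl {θ⁺ r}) (upperPiece-sum r))
                   (≈-trans (≈-sym (⊗-assoc (θ⁺ r) (qpow (K * E r)) (inv qFact∞))) (⊗-cong (θ⁺-lift r) (≈-refl {inv qFact∞})))))
                (sumInf-cong (λ σ → ≈-trans (⊗-cong (≈-refl {θ⁻ (suc σ)}) (lowerPiece-sum σ))
                   (≈-trans (≈-sym (⊗-assoc (θ⁻ (suc σ)) (qpow (K * (suc σ * (suc σ + e)))) (inv qFact∞)))
                            (⊗-cong (θ⁻-lift σ) (≈-refl {inv qFact∞}))))) ⟩
        sumInf (λ r → Θ.θ⁺ r ⊗ inv qFact∞) ⊕ sumInf (λ σ → Θ.θ⁻ (suc σ) ⊗ inv qFact∞)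
      ≈⟨ ≈-sym (⊕-cong (sumInf-⊗ʳ Θ.ord≥-θ⁺ (inv qFact∞)) (sumInf-⊗ʳ Θ.summable-θ⁻-suc (inv qFact∞))) ⟩
        sumInf Θ.θ⁺ ⊗ inv qFact∞ ⊕ sumInf (λ σ → Θ.θ⁻ (suc σ)) ⊗ inv qFact∞
      ≈⟨ ≈-sym (⊗-distribʳ-⊕ (inv qFact∞) (sumInf Θ.θ⁺) (sumInf (λ σ → Θ.θ⁻ (suc σ)))) ⟩
        (sumInf Θ.θ⁺ ⊕ sumInf (λ σ → Θ.θ⁻ (suc σ))) ⊗ inv qFact∞
      ≈⟨ ⊗-cong (≈-sym Θ.jacobiTripleProduct) (≈-refl {inv qFact∞}) ⟩
        qPoch∞ I′ Θ.K ⊗ qPoch∞ J′ Θ.K ⊗ Θ.qFact∞ ⊗ inv qFact∞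
      ∎
      where open ≈-Reasoning

module EvenCase (i j : ℕ) (1≤i : 1 ≤ i) (1≤j : 1 ≤ j) where

  open Bilateral i j 1≤i 1≤j 0 public

  I′+J′≡3K : K + i + J′ ≡ 3 * K
  I′+J′≡3K = size i j
    where
    size : ∀ i j → i + j + i + (i + j + (i + j) * 0 + j) ≡ 3 * (i + j)
    size = ℕ-Solver.solve-∀

  open InBase3K (K + i) (ℕ.≤-trans 1≤i (ℕ.m≤n+m i K)) I′+J′≡3K public

  upperPiece-sum : ∀ r → sumInf (λ n → upperPiece n r) ≈ qpow (K * (r * r)) ⊗ inv qFact∞
  upperPiece-sum r = durfee-shifted r (r + r) (r * r) (λ n → ord≥-upperPiece n r)
    (λ n n<r → upperPiece-≥ n r (subst (λ z → suc z ≤ r) (sym (ℕ.+-identityʳ n)) n<r))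
    (λ s → ≈-trans (upperPiece-< (r + s) r (s≤s (ℕ.≤-trans (ℕ.m≤m+n r s) (ℕ.m≤m+n (r + s) 0))))
      (piece-durfee (r + s) (r + s + r) (r * r) (r + r) s (exponent r s)
        (≈-trans (⊗-comm (inv (qFact (r + s + r))) (inv (qFact ((r + s) + ((r + s) + 0) ∸ (r + s + r)))))
          (≈-reflexive (cong₂ (λ a b → inv (qFact a) ⊗ inv (qFact b))
            (trans (cong (_∸ (r + s + r)) (size r s)) (ℕ.m+n∸m≡n (r + s + r) s)) (reorder r s))))))
    where
    exponent : ∀ r s → (r + s) * ((r + s) + 0) ≡ r * r + s * (s + (r + r))
    exponent = ℕ-Solver.solve-∀
    reorder : ∀ r s → r + s + r ≡ s + (r + r)
    reorder = ℕ-Solver.solve-∀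
    size : ∀ r s → (r + s) + ((r + s) + 0) ≡ (r + s + r) + s
    size = ℕ-Solver.solve-∀

  θ⁺-lift : ∀ r → θ⁺ r ⊗ qpow (K * (r * r)) ≈ Θ.θ⁺ r
  θ⁺-lift r = ≈-trans (±qpow-⊗-qpow r (K * choose₂ r + i * r) (K * (r * r))) (±qpow-cong r (begin
      K * c + i * r + K * (r * r)        ≡⟨ cong (λ z → K * c + i * r + K * z) (choose₂-square r) ⟩
      K * c + i * r + K * (c + c + r)    ≡⟨ collect K i r c ⟩
      3 * K * c + (K + i) * r            ≡⟨ cong (λ z → z * c + (K + i) * r) (sym I′+J′≡3K) ⟩
      (K + i + J′) * c + (K + i) * r     ∎))
    where
    open ≡-Reasoning
    c : ℕ
    c = choose₂ r
    collect : ∀ K i r c → K * c + i * r + K * (c + c + r) ≡ 3 * K * c + (K + i) * r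
    collect = ℕ-Solver.solve-∀

  evenSum : sumInf summand ≈ qPoch∞ (K + i) Θ.K ⊗ qPoch∞ J′ Θ.K ⊗ Θ.qFact∞ ⊗ inv qFact∞
  evenSum = bilateral (λ r → r * r) upperPiece-sum θ⁺-lift

module OddCase (i j : ℕ) (1≤i : 1 ≤ i) (1≤j : 1 ≤ j) where

  open Bilateral i j 1≤i 1≤j 1 public

  I′+J′≡3K : i + J′ ≡ 3 * K
  I′+J′≡3K = size i j
    where
    size : ∀ i j → i + (i + j + (i + j) * 1 + j) ≡ 3 * (i + j)
    size = ℕ-Solver.solve-∀

  open InBase3K i 1≤i I′+J′≡3K public

  E : ℕ → ℕ
  E zero    = 0
  E (suc r) = r * suc r

  upperPiece-sum : ∀ r → sumInf (λ n → upperPiece n r) ≈ qpow (K * E r) ⊗ inv qFact∞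
  upperPiece-sum zero = durfee-shifted 0 1 0 (λ n → ord≥-upperPiece n 0) (λ n ())
    (λ s → ≈-trans (upperPiece-< s 0 (s≤s z≤n))
      (piece-durfee s (s + 0) 0 1 s refl
        (≈-reflexive (cong₂ (λ a b → inv (qFact a) ⊗ inv (qFact b)) (ℕ.+-identityʳ s)
          (trans (cong (_∸ (s + 0)) (size s)) (ℕ.m+n∸m≡n (s + 0) (s + 1)))))))
    where
    size : ∀ s → s + (s + 1) ≡ (s + 0) + (s + 1)
    size = ℕ-Solver.solve-∀
  upperPiece-sum (suc r) = durfee-shifted r (r + suc r) (r * suc r) (λ n → ord≥-upperPiece n (suc r))
    (λ n n<r → upperPiece-≥ n (suc r) (s≤s (subst (_≤ r) (ℕ.+-comm 1 n) n<r)))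
    (λ s → ≈-trans (upperPiece-< (r + s) (suc r) (s≤s (ℕ.≤-trans (s≤s (ℕ.m≤m+n r s)) (ℕ.≤-reflexive (ℕ.+-comm 1 (r + s))))))
      (piece-durfee (r + s) (r + s + suc r) (r * suc r) (r + suc r) s (exponent r s)
        (≈-trans (⊗-comm (inv (qFact (r + s + suc r))) (inv (qFact ((r + s) + ((r + s) + 1) ∸ (r + s + suc r)))))
          (≈-reflexive (cong₂ (λ a b → inv (qFact a) ⊗ inv (qFact b))
            (trans (cong (_∸ (r + s + suc r)) (size r s)) (ℕ.m+n∸m≡n (r + s + suc r) s)) (reorder r s))))))
    where
    exponent : ∀ r s → (r + s) * ((r + s) + 1) ≡ r * suc r + s * (s + (r + suc r))
    exponent = ℕ-Solver.solve-∀
    reorder : ∀ r s → r + s + suc r ≡ s + (r + suc r)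
    reorder = ℕ-Solver.solve-∀
    size : ∀ r s → (r + s) + ((r + s) + 1) ≡ (r + s + suc r) + s
    size = ℕ-Solver.solve-∀

  θ⁺-lift : ∀ r → θ⁺ r ⊗ qpow (K * E r) ≈ Θ.θ⁺ r
  θ⁺-lift zero    = ≈-trans (qpow-+ (K * 0 + i * 0) (K * 0)) (qpow-cong (vanish K i (i + J′)))
    where
    vanish : ∀ K i L → K * 0 + i * 0 + K * 0 ≡ L * 0 + i * 0
    vanish = ℕ-Solver.solve-∀
  θ⁺-lift (suc r) = ≈-trans (±qpow-⊗-qpow (suc r) (K * choose₂ (suc r) + i * suc r) (K * (r * suc r)))
    (±qpow-cong (suc r) (begin
      K * (r + c) + i * suc r + K * (r * suc r)       ≡⟨ cong (λ z → K * (r + c) + i * suc r + K * z) (trans (expand r) (cong (_+ r) (choose₂-square r))) ⟩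
      K * (r + c) + i * suc r + K * (c + c + r + r)   ≡⟨ collect K i r c ⟩
      3 * K * (r + c) + i * suc r                     ≡⟨ cong (λ z → z * (r + c) + i * suc r) (sym I′+J′≡3K) ⟩
      (i + J′) * (r + c) + i * suc r                  ∎))
    where
    open ≡-Reasoning
    c : ℕ
    c = choose₂ r
    expand : ∀ r → r * suc r ≡ r * r + r
    expand = ℕ-Solver.solve-∀
    collect : ∀ K i r c → K * (r + c) + i * suc r + K * (c + c + r + r) ≡ 3 * K * (r + c) + i * suc r
    collect = ℕ-Solver.solve-∀

  oddSum : sumInf summand ≈ qPoch∞ i Θ.K ⊗ qPoch∞ J′ Θ.K ⊗ Θ.qFact∞ ⊗ inv qFact∞
  oddSum = bilateral E upperPiece-sum θ⁺-lift

Unit-poch : ∀ e K n → 1 ≤ e → Unit (poch (qpow e) (qpow K) n)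
Unit-poch e K n 1≤e = Unit-cong (≈-sym (poch-qpow e K n)) (Unit-qPoch e K n 1≤e)

evenIdentity : ∀ i j → 1 ≤ i → 1 ≤ j →
  sumInf (λ n → qpow ((i + j) * (n * n)) ⊗ poch (qpow i) (qpow (i + j)) n ⊗ poch (qpow j) (qpow (i + j)) n
                  ⊘ poch (qpow (i + j)) (qpow (i + j)) (2 * n))
  ≈ pochInf (qpow (i + j + i)) (qpow (3 * (i + j))) ⊗ pochInf (qpow (2 * (i + j) ∸ i)) (qpow (3 * (i + j)))
      ⊗ pochInf (qpow (3 * (i + j))) (qpow (3 * (i + j))) ⊘ pochInf (qpow (i + j)) (qpow (i + j))
evenIdentity i j 1≤i 1≤j = ≈-trans (sumInf-cong term) (≈-trans evenSum
  (≈-reflexive (cong₂ (λ b c → qPoch∞ (K + i) c ⊗ qPoch∞ b c ⊗ qPoch∞ c c ⊗ inv qFact∞) J′≡2K∸i I′+J′≡3K)))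
  where
  open EvenCase i j 1≤i 1≤j
  term : ∀ n → qpow (K * (n * n)) ⊗ poch (qpow i) (qpow K) n ⊗ poch (qpow j) (qpow K) n ⊘ poch (qpow K) (qpow K) (2 * n)
               ≈ summand n
  term n = ⊗-cong
    (⊗-cong (⊗-cong (qpow-cong (cong (λ z → K * (n * z)) (sym (ℕ.+-identityʳ n))))
                    (≈-trans (poch-qpow i K n) (≈-reflexive (cong (qPoch i K) (sym (ℕ.+-identityʳ n))))))
            (poch-qpow j K n))
    (inv-cong (Unit-poch K K (2 * n) 1≤K) (Unit-qFact (n + (n + 0)))
              (≈-trans (poch-qpow K K (2 * n)) (≈-reflexive (cong qFact (double n)))))
    where
    double : ∀ n → 2 * n ≡ n + (n + 0)
    double = ℕ-Solver.solve-∀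
  J′≡2K∸i : J′ ≡ 2 * K ∸ i
  J′≡2K∸i = sym (trans (cong (_∸ i) (size i j)) (ℕ.m+n∸m≡n i J′))
    where
    size : ∀ i j → 2 * (i + j) ≡ i + (i + j + (i + j) * 0 + j)
    size = ℕ-Solver.solve-∀

oddIdentity : ∀ i j → 1 ≤ i → 1 ≤ j →
  sumInf (λ n → qpow ((i + j) * (n * (n + 1))) ⊗ (one ⊖ qpow ((i + j) * n + i)) ⊗ poch (qpow i) (qpow (i + j)) n
                  ⊗ poch (qpow j) (qpow (i + j)) n ⊘ poch (qpow (i + j)) (qpow (i + j)) (2 * n + 1))
  ≈ pochInf (qpow i) (qpow (3 * (i + j))) ⊗ pochInf (qpow (3 * (i + j) ∸ i)) (qpow (3 * (i + j)))
      ⊗ pochInf (qpow (3 * (i + j))) (qpow (3 * (i + j))) ⊘ pochInf (qpow (i + j)) (qpow (i + j))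
oddIdentity i j 1≤i 1≤j = ≈-trans (sumInf-cong term) (≈-trans oddSum
  (≈-reflexive (cong₂ (λ b c → qPoch∞ i c ⊗ qPoch∞ b c ⊗ qPoch∞ c c ⊗ inv qFact∞) J′≡3K∸i I′+J′≡3K)))
  where
  open OddCase i j 1≤i 1≤j
  term : ∀ n → qpow (K * (n * (n + 1))) ⊗ (one ⊖ qpow (K * n + i)) ⊗ poch (qpow i) (qpow K) n ⊗ poch (qpow j) (qpow K) n
                 ⊘ poch (qpow K) (qpow K) (2 * n + 1)
               ≈ summand n
  term n = ⊗-cong
    (≈-trans (⊗-cong (⊗-cong (⊗-cong (≈-refl {qn}) (⊕-cong (≈-refl {one}) (⊝-cong (qpow-cong (ℕ.+-comm (K * n) i)))))
                             (poch-qpow i K n))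
                     (poch-qpow j K n))
    (≈-trans (solve 4 (λ a b c d → a :* b :* c :* d := a :* (c :* b) :* d) ≈-refl qn (one ⊖ qpow (i + K * n)) (qPoch i K n) (qPoch j K n))
             (⊗-cong (⊗-cong (≈-refl {qn}) (≈-reflexive (cong (qPoch i K) (ℕ.+-comm 1 n)))) (≈-refl {qPoch j K n}))))
    (inv-cong (Unit-poch K K (2 * n + 1) 1≤K) (Unit-qFact (n + (n + 1)))
              (≈-trans (poch-qpow K K (2 * n + 1)) (≈-reflexive (cong qFact (double n)))))
    where
    qn : FPS
    qn = qpow (K * (n * (n + 1)))
    double : ∀ n → 2 * n + 1 ≡ n + (n + 1)
    double = ℕ-Solver.solve-∀
  J′≡3K∸i : J′ ≡ 3 * K ∸ i
  J′≡3K∸i = sym (trans (cong (_∸ i) (size i j)) (ℕ.m+n∸m≡n i J′))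
    where
    size : ∀ i j → 3 * (i + j) ≡ i + (i + j + (i + j) * 1 + j)
    size = ℕ-Solver.solve-∀

corollary7p3 : (k i : ℕ) → 2 ≤ k → 1 ≤ i → i < k →
    ((m : ℕ) →
      sumInf (λ n → qpow (k * (n * n)) ⊗ poch (qpow i) (qpow k) n ⊗ poch (qpow (k ∸ i)) (qpow k) n
                      ⊘ poch (qpow k) (qpow k) (2 * n)) m
      ≡ (pochInf (qpow (k + i)) (qpow (3 * k)) ⊗ pochInf (qpow (2 * k ∸ i)) (qpow (3 * k))
           ⊗ pochInf (qpow (3 * k)) (qpow (3 * k)) ⊘ pochInf (qpow k) (qpow k)) m)
    × ((m : ℕ) →
      sumInf (λ n → qpow (k * (n * (n + 1))) ⊗ (one ⊖ qpow (k * n + i)) ⊗ poch (qpow i) (qpow k) n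
                      ⊗ poch (qpow (k ∸ i)) (qpow k) n ⊘ poch (qpow k) (qpow k) (2 * n + 1)) m
      ≡ (pochInf (qpow i) (qpow (3 * k)) ⊗ pochInf (qpow (3 * k ∸ i)) (qpow (3 * k))
           ⊗ pochInf (qpow (3 * k)) (qpow (3 * k)) ⊘ pochInf (qpow k) (qpow k)) m)
-- The hypothesis 2 ≤ k is implied by 1 ≤ i < k.
corollary7p3 k i _ 1≤i i<k with k ∸ i | ℕ.m+[n∸m]≡n (ℕ.<⇒≤ i<k)
... | j | refl = at (evenIdentity i j 1≤i 1≤j) , at (oddIdentity i j 1≤i 1≤j)
  where
  1≤j : 1 ≤ j
  1≤j = ℕ.+-cancelˡ-≤ i 1 j (subst (_≤ i + j) (ℕ.+-comm 1 i) i<k)
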